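{- Suppose $\det(\nu_{i+j,n})_{i,j=0}^{n}\neq0$ for all $n\ge0$. Let $\Delta''_n=\det(\nu_{i+j,j})_{0\le i,j\le n}$ and $\Delta'''_n=\det(\nu_{i,j})_{0\le i,j\le n}$. If moreover $\lambda_k\neq0$ for all $k$, then \[ Q_n(x)=\frac{1}{\Delta''_n}\det\begin{pmatrix}(\nu_{i+j,j})_{0\le i\le n-1,\ 0\le j\le n}\\ \left(\frac{x^j}{d_j(x)}\right)_{0\le j\le n}\end{pmatrix}. \] Also, \[ Q_n(x)=\frac{1}{\Delta'''_n}\det\begin{pmatrix}(\nu_{i,j})_{0\le i\le n-1,\ 0\le j\le n}\\ \left(\frac{1}{d_j(x)}\right)_{0\le j\le n}\end{pmatrix}. \]
   Context: Let $\{b_n\}_{n\ge0},\{a_n\}_{n\ge0},\{\lambda_n\}_{n\ge0}$ be sequences of complex numbers. Define monic polynomials $P_n(x)$ by $P_{ -1}(x)=0$, $P_0(x)=1$ and $P_{n+1}(x)=(x-b_n)P_n(x)-(a_nx+\lambda_n)P_{n-1}(x)$ for $n\ge0$. Let $d_0(x)=1$, $d_m(x)=\prod_{i=1}^m(a_ix+\lambda_i)$, and $Q_m(x)=P_m(x)/d_m(x)$. Assume $a_n\neq0$ and $P_n(-\lambda_n/a_n)\neq 0$ for all $n\ge1$. Let $V=\mathrm{span}\{x^nQ_m(x):n,m\ge0\}$ (rational functions; it contains every $x^n/d_m(x)$), and let $\mathcal{L}$ be the unique linear functional on $V$ with $\mathcal{L}(1)=1$ and $\mathcal{L}(x^nQ_m(x))=0$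 whenever $0\le n<m$. Set $\nu_{n,m}=\mathcal{L}(x^n/d_m(x))$. In each determinant, the first $n$ rows are indexed by $i=0,\dots,n-1$ and the last row is the displayed row of functions. -}

module Defs where

open import Level using (Level; suc)
open import Algebra.Core using (Op₁; Op₂)
open import Algebra.Structures using (IsCommutativeRing)
open import Data.Nat as ℕ using (ℕ; zero; _<_; _≤_; _≡ᵇ_)
  renaming (suc to sucℕ; _+_ to _+ℕ_)
open import Data.Fin using (Fin; toℕ; punchIn) renaming (zero to fzero; suc to fsuc)
open import Data.Fin.Properties using (toℕ≤pred[n])
open import Data.Nat.Properties using (≤-refl)
open import Data.List using (List; []; _∷_; _++_; replicate; map)
open import Data.Bool using (if_then_else_)
open import Data.Product using (_×_; _,_; proj₁; proj₂)
open import Relation.Binary.PropositionalEquality using (_≡_; _≢_)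

-- A field, with propositional equality on the carrier.
-- (The paper works over ℂ; agda-stdlib has no ℂ.)

record Field (c : Level) : Set (suc c) where
  infix  8 -_
  infixl 7 _*_
  infixl 6 _+_
  field
    Carrier           : Set c
    _+_ _*_           : Op₂ Carrier
    -_                : Op₁ Carrier
    0# 1#             : Carrier
    isCommutativeRing : IsCommutativeRing _≡_ _+_ _*_ -_ 0# 1#
    inv               : (x : Carrier) → x ≢ 0# → Carrier
    inv-inverse       : ∀ x (nz : x ≢ 0#) → inv x nz * x ≡ 1#
    1≢0               : 1# ≢ 0#

module Setup {c : Level} (F : Field c) where
  open Field F

  -- Polynomials in x over F as coefficient lists, lowest degree first.

  Poly : Set c
  Poly = List Carrier

  addP : Poly → Poly → Poly
  addP []       q        = q
  addP (p ∷ ps) []       = p ∷ ps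
  addP (p ∷ ps) (q ∷ qs) = (p + q) ∷ addP ps qs

  scaleP : Carrier → Poly → Poly
  scaleP k = map (k *_)

  shiftP : Poly → Poly
  shiftP p = 0# ∷ p

  shiftN : ℕ → Poly → Poly
  shiftN zero     p = p
  shiftN (sucℕ n) p = shiftP (shiftN n p)

  monomial : ℕ → Poly
  monomial n = replicate n 0# ++ (1# ∷ [])

  linP : Carrier → Carrier → Poly → Poly
  linP α β p = addP (scaleP α (shiftP p)) (scaleP β p)

  evalP : Poly → Carrier → Carrier
  evalP []       x = 0#
  evalP (k ∷ ks) x = k + x * evalP ks x

  _^_ : Carrier → ℕ → Carrier
  x ^ zero     = 1#
  x ^ sucℕ n   = x * (x ^ n)

  -- The polynomials P_n:  P_{-1} = 0, P_0 = 1,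
  -- P_{n+1} = (x - b_n) P_n - (a_n x + λ_n) P_{n-1}.
  -- PP n = (P_{n-1} , P_n).

  PP : (b a lam : ℕ → Carrier) → ℕ → Poly × Poly
  PP b a lam zero     = [] , (1# ∷ [])
  PP b a lam (sucℕ n) =
    proj₂ (PP b a lam n) ,
    addP (addP (shiftP (proj₂ (PP b a lam n))) (scaleP (- b n) (proj₂ (PP b a lam n))))
         (scaleP (- 1#) (linP (a n) (lam n) (proj₁ (PP b a lam n))))

  P : (b a lam : ℕ → Carrier) → ℕ → Poly
  P b a lam n = proj₂ (PP b a lam n)

  d : (a lam : ℕ → Carrier) → ℕ → Carrier → Carrier
  d a lam zero     x = 1#
  d a lam (sucℕ m) x = d a lam m x * (a (sucℕ m) * x + lam (sucℕ m))

  Q : (b a lam : ℕ → Carrier) (n : ℕ) (x : Carrier) →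
      ((j : ℕ) → j ≤ n → d a lam j x ≢ 0#) → Carrier
  Q b a lam n x hx = evalP (P b a lam n) x * inv (d a lam n x) (hx n ≤-refl)

  -- Linear functionals on V = ⋃_m {p(x)/d_m(x) : p polynomial}.
  -- A functional is encoded by  L m p = 𝓛(p(x)/d_m(x)).
  -- It is well defined on V iff it is linear in p for fixed m and
  -- compatible with  p/d_m = p·(a_{m+1}x+λ_{m+1}) / d_{m+1}.

  record IsLinearOnV (a lam : ℕ → Carrier) (L : ℕ → Poly → Carrier) : Set c where
    field
      additive    : ∀ m p q → L m (addP p q) ≡ L m p + L m q
      homogeneous : ∀ m k p → L m (scaleP k p) ≡ k * L m p
      compatible  : ∀ m p → L (sucℕ m) (linP (a (sucℕ m)) (lam (sucℕ m)) p) ≡ L m p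

  -- The moment functional 𝓛 of the paper: linear on V, 𝓛(1) = 1,
  -- 𝓛(x^n Q_m) = 0 for 0 ≤ n < m.
  record IsMomentFunctional (b a lam : ℕ → Carrier) (L : ℕ → Poly → Carrier) : Set c where
    field
      linear     : IsLinearOnV a lam L
      normalised : L 0 (1# ∷ []) ≡ 1#
      orthogonal : ∀ m n → n < m → L m (shiftN n (P b a lam m)) ≡ 0#

  ν : (L : ℕ → Poly → Carrier) → ℕ → ℕ → Carrier
  ν L n m = L m (monomial n)

  sumFin : (n : ℕ) → (Fin n → Carrier) → Carrier
  sumFin zero     f = 0#
  sumFin (sucℕ n) f = f fzero + sumFin n (λ i → f (fsuc i))

  alt : ℕ → Carrier
  alt zero     = 1#
  alt (sucℕ k) = - alt k

  det : (n : ℕ) → (Fin n → Fin n → Carrier) → Carrier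
  det zero     M = 1#
  det (sucℕ n) M =
    sumFin (sucℕ n) (λ j → alt (toℕ j) * M fzero j * det n (λ i k → M (fsuc i) (punchIn j k)))

  bordered : (n : ℕ) → (ℕ → ℕ → Carrier) → (Fin (sucℕ n) → Carrier) →
             Fin (sucℕ n) → Fin (sucℕ n) → Carrier
  bordered n row last i j =
    if toℕ i ≡ᵇ n then last j else row (toℕ i) (toℕ j)

  Δ'' : (L : ℕ → Poly → Carrier) → ℕ → Carrier
  Δ'' L n = det (sucℕ n) (λ i j → ν L (toℕ i +ℕ toℕ j) (toℕ j))

  Δ''' : (L : ℕ → Poly → Carrier) → ℕ → Carrier
  Δ''' L n = det (sucℕ n) (λ i j → ν L (toℕ i) (toℕ j))

  hankel : (L : ℕ → Poly → Carrier) → ℕ → Carrier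
  hankel L n = det (sucℕ n) (λ i j → ν L (toℕ i +ℕ toℕ j) n)

  lastRow'' : (a lam : ℕ → Carrier) (n : ℕ) (x : Carrier) →
              ((j : ℕ) → j ≤ n → d a lam j x ≢ 0#) → Fin (sucℕ n) → Carrier
  lastRow'' a lam n x hx j = (x ^ toℕ j) * inv (d a lam (toℕ j) x) (hx (toℕ j) (toℕ≤pred[n] j))

  lastRow''' : (a lam : ℕ → Carrier) (n : ℕ) (x : Carrier) →
               ((j : ℕ) → j ≤ n → d a lam j x ≢ 0#) → Fin (sucℕ n) → Carrier
  lastRow''' a lam n x hx j = inv (d a lam (toℕ j) x) (hx (toℕ j) (toℕ≤pred[n] j))

-- Fix a basis β_j of polynomials of degree j (x^j, resp. 1) with β_{m+1} nonzero at the root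
-- -λ_{m+1}/a_{m+1} of the factor by which d_{m+1} exceeds d_m; for x^j this is where λ_k ≠ 0 is used.
-- Peeling off these factors one at a time writes Q_k = Σ_{j ≤ k} T_{jk} β_j / d_j.  The triangular
-- column operations T turn the matrix (𝓛(x^i β_j / d_j))_{i,j} = (ν_{i+j,j}), resp. (ν_{i,j}), into
-- (𝓛(x^i Q_k))_{i,k}, which is lower triangular with unit diagonal: 𝓛(x^i Q_k) = 0 for i < k by
-- definition, and 𝓛(x^k Q_k) = 𝓛(x^{k-1} Q_{k-1}) by pairing the recurrence for P_{k+1} with
-- x^{k-1} / d_k.  Hence (∏ T_kk) Δ = 1.  Replacing the last row by (β_j(x) / d_j(x))_j, the same
-- column operations produce the last row (Q_k(x))_k, so the bordered determinant times ∏ T_kk is Q_n(x).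

module Submission where

open import Defs
open import Level using (Level)
open import Data.Nat using (ℕ; _≤_; suc) renaming (_+_ to _+ℕ_)
open import Data.Product using (Σ; _×_)
open import Relation.Binary.PropositionalEquality using (_≡_; _≢_)

open import Algebra.Bundles using (CommutativeRing; RawRing)
open import Algebra.Solver.Ring.AlmostCommutativeRing using (AlmostCommutativeRing; fromCommutativeRing; _-Raw-AlmostCommutative⟶_)
open import Data.Bool using (true; false; T)
open import Data.Empty using (⊥-elim)
open import Data.Fin using (Fin; toℕ; fromℕ; fromℕ<; punchIn; punchOut; inject₁) renaming (zero to fzero; suc to fsuc)
import Data.Fin.Properties as FP
open import Data.Integer as ℤ using (ℤ; -[1+_]; sign; ∣_∣; _◃_; _⊖_) renaming (+_ to pos)
import Data.Integer.Properties as ℤP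
open import Data.List using ([]; _∷_; length)
import Data.List.Properties as LP
open import Data.Maybe using (Maybe; just; nothing)
open import Data.Nat as ℕ using (zero; z≤n; s≤s; _≡ᵇ_)
import Data.Nat.Properties as ℕP
open import Data.Product using (_,_; proj₁; proj₂)
open import Data.Sign as Sign using (Sign)
open import Data.Sum using (inj₁; inj₂)
open import Function using (_∘_)
open import Relation.Binary.Definitions using (tri<; tri≈; tri>)
open import Relation.Binary.PropositionalEquality using (refl; sym; trans; cong; cong₂; subst; subst₂; module ≡-Reasoning)
open import Relation.Nullary using (yes; no)

module FieldSolver {c : Level} (F : Field c) where
  open Field F

  -- Solver normal forms carry ℤ coefficients, mapped into F by embedℤ; that is what lets it
  -- cancel x + - x, which coefficients taken from F itself could not.
  private
    commutativeRing : CommutativeRing c c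
    commutativeRing = record { isCommutativeRing = isCommutativeRing }

    open CommutativeRing commutativeRing using (+-assoc; +-comm; -‿inverseʳ; +-identityʳ; semiring; ring)
    open import Algebra.Properties.Ring ring using (-‿involutive; -0#≈0#; -‿distribˡ-*; -‿distribʳ-*; -‿+-comm)
    open import Algebra.Properties.Semiring.Mult.TCOptimised semiring using (×-homo-+; ×1-homo-*) renaming (_×_ to _·_)
    open ≡-Reasoning

    embedℕ : ℕ → Carrier
    embedℕ n = n · 1#

    signed : Sign → Carrier → Carrier
    signed Sign.+ x = x
    signed Sign.- x = - x

    embedℤ : ℤ → Carrier
    embedℤ i = signed (sign i) (embedℕ ∣ i ∣)

    embedℤ-◃ : ∀ s n → embedℤ (s ◃ n) ≡ signed s (embedℕ n)
    embedℤ-◃ Sign.+ zero    = refl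
    embedℤ-◃ Sign.- zero    = sym -0#≈0#
    embedℤ-◃ Sign.+ (suc n) = refl
    embedℤ-◃ Sign.- (suc n) = refl

    signed-* : ∀ s t x y → signed (s Sign.* t) (x * y) ≡ signed s x * signed t y
    signed-* Sign.+ Sign.+ x y = refl
    signed-* Sign.+ Sign.- x y = -‿distribʳ-* x y
    signed-* Sign.- Sign.+ x y = -‿distribˡ-* x y
    signed-* Sign.- Sign.- x y = begin
      x * y         ≡⟨ sym (-‿involutive _) ⟩
      - (- (x * y)) ≡⟨ cong -_ (-‿distribˡ-* x y) ⟩
      - (- x * y)   ≡⟨ -‿distribʳ-* (- x) y ⟩
      - x * - y     ∎

    embedℤ-* : ∀ i j → embedℤ (i ℤ.* j) ≡ embedℤ i * embedℤ j
    embedℤ-* i j = begin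
      embedℤ (s ◃ ∣ i ∣ ℕ.* ∣ j ∣)              ≡⟨ embedℤ-◃ s (∣ i ∣ ℕ.* ∣ j ∣) ⟩
      signed s (embedℕ (∣ i ∣ ℕ.* ∣ j ∣))      ≡⟨ cong (signed s) (×1-homo-* ∣ i ∣ ∣ j ∣) ⟩
      signed s (embedℕ ∣ i ∣ * embedℕ ∣ j ∣)   ≡⟨ signed-* (sign i) (sign j) (embedℕ ∣ i ∣) (embedℕ ∣ j ∣) ⟩
      embedℤ i * embedℤ j                      ∎
      where s = sign i Sign.* sign j

    embedℤ-neg : ∀ i → embedℤ (ℤ.- i) ≡ - embedℤ i
    embedℤ-neg -[1+ n ]      = sym (-‿involutive _)
    embedℤ-neg (pos zero)    = sym -0#≈0#
    embedℤ-neg (pos (suc n)) = refl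

    +-cancelˡ-neg : ∀ a x → (a + x) + - a ≡ x
    +-cancelˡ-neg a x = begin
      (a + x) + - a ≡⟨ cong (_+ - a) (+-comm a x) ⟩
      (x + a) + - a ≡⟨ +-assoc x a (- a) ⟩
      x + (a + - a) ≡⟨ cong (x +_) (-‿inverseʳ a) ⟩
      x + 0#        ≡⟨ +-identityʳ x ⟩
      x             ∎

    embedℤ-⊖ : ∀ m n → embedℤ (m ⊖ n) ≡ embedℕ m + - embedℕ n
    embedℤ-⊖ m n with ℕP.≤-<-connex m n
    ... | inj₁ m≤n = begin
      embedℤ (m ⊖ n)                              ≡⟨ cong embedℤ (ℤP.⊖-≤ m≤n) ⟩
      embedℤ (ℤ.- pos k)                          ≡⟨ embedℤ-neg (pos k) ⟩
      - embedℕ k                                  ≡⟨ sym (+-cancelˡ-neg (embedℕ m) _) ⟩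
      (embedℕ m + - embedℕ k) + - embedℕ m        ≡⟨ +-assoc _ _ _ ⟩
      embedℕ m + (- embedℕ k + - embedℕ m)        ≡⟨ cong (embedℕ m +_) (-‿+-comm _ _) ⟩
      embedℕ m + - (embedℕ k + embedℕ m)          ≡⟨ cong (λ z → embedℕ m + - z) (+-comm _ _) ⟩
      embedℕ m + - (embedℕ m + embedℕ k)          ≡⟨ cong (λ z → embedℕ m + - z) (sym (×-homo-+ 1# m k)) ⟩
      embedℕ m + - embedℕ (m ℕ.+ k)               ≡⟨ cong (λ z → embedℕ m + - embedℕ z) (ℕP.m+[n∸m]≡n m≤n) ⟩
      embedℕ m + - embedℕ n                       ∎
      where k = n ℕ.∸ m
    ... | inj₂ n<m = begin
      embedℤ (m ⊖ n)                              ≡⟨ cong embedℤ (ℤP.⊖-≥ (ℕP.<⇒≤ n<m)) ⟩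
      embedℕ k                                    ≡⟨ sym (+-cancelˡ-neg (embedℕ n) _) ⟩
      (embedℕ n + embedℕ k) + - embedℕ n          ≡⟨ cong (_+ - embedℕ n) (sym (×-homo-+ 1# n k)) ⟩
      embedℕ (n ℕ.+ k) + - embedℕ n               ≡⟨ cong (λ z → embedℕ z + - embedℕ n) (ℕP.m+[n∸m]≡n (ℕP.<⇒≤ n<m)) ⟩
      embedℕ m + - embedℕ n                       ∎
      where k = m ℕ.∸ n

    embedℤ-+ : ∀ i j → embedℤ (i ℤ.+ j) ≡ embedℤ i + embedℤ j
    embedℤ-+ -[1+ m ] -[1+ n ] = begin
      - embedℕ (suc (suc (m ℕ.+ n)))        ≡⟨ cong (λ z → - embedℕ (suc z)) (sym (ℕP.+-suc m n)) ⟩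
      - embedℕ (suc m ℕ.+ suc n)            ≡⟨ cong -_ (×-homo-+ 1# (suc m) (suc n)) ⟩
      - (embedℕ (suc m) + embedℕ (suc n))   ≡⟨ sym (-‿+-comm _ _) ⟩
      - embedℕ (suc m) + - embedℕ (suc n)   ∎
    embedℤ-+ -[1+ m ] (pos n) = trans (embedℤ-⊖ n (suc m)) (+-comm _ _)
    embedℤ-+ (pos m) -[1+ n ] = embedℤ-⊖ m (suc n)
    embedℤ-+ (pos m) (pos n)  = ×-homo-+ 1# m n

    ℤ-rawRing : RawRing _ _
    ℤ-rawRing = record
      { Carrier = ℤ ; _≈_ = _≡_ ; _+_ = ℤ._+_ ; _*_ = ℤ._*_ ; -_ = ℤ.-_ ; 0# = pos 0 ; 1# = pos 1 }

    almostCommutativeRing : AlmostCommutativeRing c c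
    almostCommutativeRing = fromCommutativeRing commutativeRing

    embedℤ-homomorphism : ℤ-rawRing -Raw-AlmostCommutative⟶ almostCommutativeRing
    embedℤ-homomorphism = record
      { ⟦_⟧ = embedℤ ; +-homo = embedℤ-+ ; *-homo = embedℤ-* ; -‿homo = embedℤ-neg ; 0-homo = refl ; 1-homo = refl }

    embedℤ-cong? : ∀ i j → Maybe (embedℤ i ≡ embedℤ j)
    embedℤ-cong? i j with i ℤ.≟ j
    ... | yes i≡j = just (cong embedℤ i≡j)
    ... | no _    = nothing

  open import Algebra.Solver.Ring ℤ-rawRing almostCommutativeRing embedℤ-homomorphism embedℤ-cong? public

  :0 :1 : ∀ {n} → Polynomial n
  :0 = con (pos 0)
  :1 = con (pos 1)

module FieldLemmas {c : Level} (F : Field c) where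
  open Field F
  open Setup F using (_^_)
  open FieldSolver F
  open ≡-Reasoning

  inv-unique : ∀ x nz y → y * x ≡ 1# → inv x nz ≡ y
  inv-unique x nz y yx≡1 = begin
    inv x nz            ≡⟨ solve 1 (λ i → i := i :* :1) refl (inv x nz) ⟩
    inv x nz * 1#       ≡⟨ cong (inv x nz *_) (sym yx≡1) ⟩
    inv x nz * (y * x)  ≡⟨ solve 3 (λ i y x → i :* (y :* x) := y :* (i :* x)) refl (inv x nz) y x ⟩
    y * (inv x nz * x)  ≡⟨ cong (y *_) (inv-inverse x nz) ⟩
    y * 1#              ≡⟨ solve 1 (λ y → y :* :1 := y) refl y ⟩
    y                   ∎

  inv-irrelevant : ∀ x p q → inv x p ≡ inv x q
  inv-irrelevant x p q = inv-unique x p (inv x q) (inv-inverse x q)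

  *-nonzero : ∀ x y → x ≢ 0# → y ≢ 0# → x * y ≢ 0#
  *-nonzero x y x≢0 y≢0 xy≡0 = y≢0 (begin
    y                   ≡⟨ solve 1 (λ y → y := :1 :* y) refl y ⟩
    1# * y              ≡⟨ cong (_* y) (sym (inv-inverse x x≢0)) ⟩
    inv x x≢0 * x * y   ≡⟨ solve 3 (λ i x y → i :* x :* y := i :* (x :* y)) refl (inv x x≢0) x y ⟩
    inv x x≢0 * (x * y) ≡⟨ cong (inv x x≢0 *_) xy≡0 ⟩
    inv x x≢0 * 0#      ≡⟨ solve 1 (λ i → i :* :0 := :0) refl (inv x x≢0) ⟩
    0#                  ∎)

  inv-nonzero : ∀ x nz → inv x nz ≢ 0#
  inv-nonzero x nz i≡0 = 1≢0 (begin
    1#           ≡⟨ sym (inv-inverse x nz) ⟩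
    inv x nz * x ≡⟨ cong (_* x) i≡0 ⟩
    0# * x       ≡⟨ solve 1 (λ x → :0 :* x := :0) refl x ⟩
    0#           ∎)

  -‿nonzero : ∀ x → x ≢ 0# → - x ≢ 0#
  -‿nonzero x x≢0 -x≡0 = x≢0 (begin
    x       ≡⟨ solve 1 (λ x → x := :- (:- x)) refl x ⟩
    - (- x) ≡⟨ cong -_ -x≡0 ⟩
    - 0#    ≡⟨ solve 0 (:- :0 := :0) refl ⟩
    0#      ∎)

  ^-nonzero : ∀ x k → x ≢ 0# → x ^ k ≢ 0#
  ^-nonzero x zero    x≢0 = 1≢0
  ^-nonzero x (suc k) x≢0 = *-nonzero x (x ^ k) x≢0 (^-nonzero x k x≢0)

  *≡1⇒≢0ʳ : ∀ x y → x * y ≡ 1# → y ≢ 0#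
  *≡1⇒≢0ʳ x y xy≡1 y≡0 = 1≢0 (begin
    1#     ≡⟨ sym xy≡1 ⟩
    x * y  ≡⟨ cong (x *_) y≡0 ⟩
    x * 0# ≡⟨ solve 1 (λ x → x :* :0 := :0) refl x ⟩
    0#     ∎)

  +≡0⇒≡- : ∀ x y → x + y ≡ 0# → x ≡ - y
  +≡0⇒≡- x y x+y≡0 = begin
    x             ≡⟨ solve 2 (λ x y → x := (x :+ y) :- y) refl x y ⟩
    (x + y) + - y ≡⟨ cong (_+ - y) x+y≡0 ⟩
    0# + - y      ≡⟨ solve 1 (λ y → :0 :- y := :- y) refl y ⟩
    - y           ∎

module FiniteSums {c : Level} (F : Field c) where
  open Field F
  open Setup F using (sumFin)
  open FieldSolver F
  open ≡-Reasoning

  sumFin-cong : ∀ N {f g : Fin N → Carrier} → (∀ i → f i ≡ g i) → sumFin N f ≡ sumFin N g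
  sumFin-cong zero    f≗g = refl
  sumFin-cong (suc N) f≗g = cong₂ _+_ (f≗g fzero) (sumFin-cong N (f≗g ∘ fsuc))

  sumFin-zero : ∀ N (f : Fin N → Carrier) → (∀ i → f i ≡ 0#) → sumFin N f ≡ 0#
  sumFin-zero zero    f f≗0 = refl
  sumFin-zero (suc N) f f≗0 = begin
    f fzero + sumFin N (f ∘ fsuc) ≡⟨ cong₂ _+_ (f≗0 fzero) (sumFin-zero N (f ∘ fsuc) (f≗0 ∘ fsuc)) ⟩
    0# + 0#                       ≡⟨ solve 0 (:0 :+ :0 := :0) refl ⟩
    0#                            ∎

  sumFin-0* : ∀ N (f : Fin N → Carrier) → sumFin N (λ i → 0# * f i) ≡ 0#
  sumFin-0* N f = sumFin-zero N (λ i → 0# * f i) (λ i → solve 1 (λ y → :0 :* y := :0) refl (f i))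

  sumFin-linear : ∀ N (f g : Fin N → Carrier) s →
                  sumFin N (λ i → f i + s * g i) ≡ sumFin N f + s * sumFin N g
  sumFin-linear zero    f g s = solve 1 (λ s → :0 := :0 :+ s :* :0) refl s
  sumFin-linear (suc N) f g s = begin
    (f fzero + s * g fzero) + sumFin N (λ i → f (fsuc i) + s * g (fsuc i))
      ≡⟨ cong ((f fzero + s * g fzero) +_) (sumFin-linear N (f ∘ fsuc) (g ∘ fsuc) s) ⟩
    (f fzero + s * g fzero) + (sumFin N (f ∘ fsuc) + s * sumFin N (g ∘ fsuc))
      ≡⟨ solve 5 (λ a b s A B → (a :+ s :* b) :+ (A :+ s :* B) := (a :+ A) :+ s :* (b :+ B)) refl
           (f fzero) (g fzero) s (sumFin N (f ∘ fsuc)) (sumFin N (g ∘ fsuc)) ⟩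
    (f fzero + sumFin N (f ∘ fsuc)) + s * (g fzero + sumFin N (g ∘ fsuc)) ∎

  sumFin-*ˡ : ∀ N (f : Fin N → Carrier) s → sumFin N (λ i → s * f i) ≡ s * sumFin N f
  sumFin-*ˡ N f s = begin
    sumFin N (λ i → s * f i)               ≡⟨ sumFin-cong N (λ i → solve 2 (λ s x → s :* x := :0 :+ s :* x) refl s (f i)) ⟩
    sumFin N (λ i → 0# + s * f i)          ≡⟨ sumFin-linear N (λ _ → 0#) f s ⟩
    sumFin N (λ _ → 0#) + s * sumFin N f   ≡⟨ cong (_+ s * sumFin N f) (sumFin-zero N _ (λ _ → refl)) ⟩
    0# + s * sumFin N f                    ≡⟨ solve 2 (λ s S → :0 :+ s :* S := s :* S) refl s (sumFin N f) ⟩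
    s * sumFin N f                         ∎

  sumFin-single : ∀ N (k : Fin N) (f : Fin N → Carrier) → (∀ l → l ≢ k → f l ≡ 0#) → sumFin N f ≡ f k
  sumFin-single (suc N) fzero f f≗0 = begin
    f fzero + sumFin N (f ∘ fsuc) ≡⟨ cong (f fzero +_) (sumFin-zero N (f ∘ fsuc) (λ l → f≗0 (fsuc l) λ ())) ⟩
    f fzero + 0#                  ≡⟨ solve 1 (λ x → x :+ :0 := x) refl (f fzero) ⟩
    f fzero                       ∎
  sumFin-single (suc N) (fsuc k) f f≗0 = begin
    f fzero + sumFin N (f ∘ fsuc)
      ≡⟨ cong₂ _+_ (f≗0 fzero λ ()) (sumFin-single N k (f ∘ fsuc) (λ l l≢k → f≗0 (fsuc l) (l≢k ∘ FP.suc-injective))) ⟩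
    0# + f (fsuc k)               ≡⟨ solve 1 (λ x → :0 :+ x := x) refl (f (fsuc k)) ⟩
    f (fsuc k)                    ∎

  sumFin-pair : ∀ N (j k : Fin N) (f : Fin N → Carrier) → j ≢ k →
                (∀ l → l ≢ j → l ≢ k → f l ≡ 0#) → sumFin N f ≡ f j + f k
  sumFin-pair (suc N) fzero    fzero    f j≢k f≗0 = ⊥-elim (j≢k refl)
  sumFin-pair (suc N) fzero    (fsuc k) f j≢k f≗0 =
    cong (f fzero +_) (sumFin-single N k (f ∘ fsuc) (λ l l≢k → f≗0 (fsuc l) (λ ()) (l≢k ∘ FP.suc-injective)))
  sumFin-pair (suc N) (fsuc j) fzero    f j≢k f≗0 = begin
    f fzero + sumFin N (f ∘ fsuc)
      ≡⟨ cong (f fzero +_) (sumFin-single N j (f ∘ fsuc) (λ l l≢j → f≗0 (fsuc l) (l≢j ∘ FP.suc-injective) λ ())) ⟩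
    f fzero + f (fsuc j)          ≡⟨ solve 2 (λ x y → x :+ y := y :+ x) refl (f fzero) (f (fsuc j)) ⟩
    f (fsuc j) + f fzero          ∎
  sumFin-pair (suc N) (fsuc j) (fsuc k) f j≢k f≗0 = begin
    f fzero + sumFin N (f ∘ fsuc)   ≡⟨ cong₂ _+_ (f≗0 fzero (λ ()) (λ ())) (sumFin-pair N j k (f ∘ fsuc) (j≢k ∘ cong fsuc) f∘suc≗0) ⟩
    0# + (f (fsuc j) + f (fsuc k))  ≡⟨ solve 2 (λ x y → :0 :+ (x :+ y) := x :+ y) refl (f (fsuc j)) (f (fsuc k)) ⟩
    f (fsuc j) + f (fsuc k)         ∎
    where
    f∘suc≗0 : ∀ l → l ≢ j → l ≢ k → f (fsuc l) ≡ 0#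
    f∘suc≗0 l l≢j l≢k = f≗0 (fsuc l) (l≢j ∘ FP.suc-injective) (l≢k ∘ FP.suc-injective)

  pointMass : ℕ → Carrier → ℕ → Carrier
  pointMass K x j with j ℕ.≟ K
  ... | yes _ = x
  ... | no _  = 0#

  pointMass-at : ∀ K x → pointMass K x K ≡ x
  pointMass-at K x with K ℕ.≟ K
  ... | yes _  = refl
  ... | no K≢K = ⊥-elim (K≢K refl)

  pointMass-off : ∀ K x j → j ≢ K → pointMass K x j ≡ 0#
  pointMass-off K x j j≢K with j ℕ.≟ K
  ... | yes j≡K = ⊥-elim (j≢K j≡K)
  ... | no _    = refl

  sumFin-pointMass : ∀ N K x (X : ℕ → Carrier) → K ℕ.< N →
                     sumFin N (λ j → pointMass K x (toℕ j) * X (toℕ j)) ≡ x * X K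
  sumFin-pointMass N K x X K<N = begin
    sumFin N (λ j → pointMass K x (toℕ j) * X (toℕ j)) ≡⟨ sumFin-single N k _ off-k ⟩
    pointMass K x (toℕ k) * X (toℕ k)                  ≡⟨ cong (λ n → pointMass K x n * X n) (FP.toℕ-fromℕ< K<N) ⟩
    pointMass K x K * X K                              ≡⟨ cong (_* X K) (pointMass-at K x) ⟩
    x * X K                                            ∎
    where
    k = fromℕ< K<N
    off-k : ∀ l → l ≢ k → pointMass K x (toℕ l) * X (toℕ l) ≡ 0#
    off-k l l≢k = begin
      pointMass K x (toℕ l) * X (toℕ l)
        ≡⟨ cong (_* X (toℕ l)) (pointMass-off K x (toℕ l) (λ l≡K → l≢k (FP.toℕ-injective (trans l≡K (sym (FP.toℕ-fromℕ< K<N)))))) ⟩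
      0# * X (toℕ l)                    ≡⟨ solve 1 (λ y → :0 :* y := :0) refl (X (toℕ l)) ⟩
      0#                                ∎

  sumFin-pointMass-+ : ∀ N K x s (e X : ℕ → Carrier) → K ℕ.< N →
    sumFin N (λ j → (pointMass K x (toℕ j) + s * e (toℕ j)) * X (toℕ j)) ≡ x * X K + s * sumFin N (λ j → e (toℕ j) * X (toℕ j))
  sumFin-pointMass-+ N K x s e X K<N = begin
    sumFin N (λ j → (pointMass K x (toℕ j) + s * e (toℕ j)) * X (toℕ j))
      ≡⟨ sumFin-cong N (λ j → solve 4 (λ δ s e x → (δ :+ s :* e) :* x := δ :* x :+ s :* (e :* x)) refl
                                 (pointMass K x (toℕ j)) s (e (toℕ j)) (X (toℕ j))) ⟩
    sumFin N (λ j → pointMass K x (toℕ j) * X (toℕ j) + s * (e (toℕ j) * X (toℕ j)))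
      ≡⟨ sumFin-linear N _ _ s ⟩
    sumFin N (λ j → pointMass K x (toℕ j) * X (toℕ j)) + s * sumFin N (λ j → e (toℕ j) * X (toℕ j))
      ≡⟨ cong (_+ s * sumFin N (λ j → e (toℕ j) * X (toℕ j))) (sumFin-pointMass N K x X K<N) ⟩
    x * X K + s * sumFin N (λ j → e (toℕ j) * X (toℕ j)) ∎

module Determinants {c : Level} (F : Field c) where
  open Field F
  open Setup F using (det; alt; sumFin)
  open FieldSolver F
  open FieldLemmas F
  open FiniteSums F
  open ≡-Reasoning

  Mat : ℕ → Set c
  Mat N = Fin N → Fin N → Carrier

  minor : ∀ {N} → Mat (suc N) → Fin (suc N) → Mat N
  minor M l i k = M (fsuc i) (punchIn l k)

  laplaceTerm : ∀ {N} → Mat (suc N) → Fin (suc N) → Carrier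
  laplaceTerm {N} M l = alt (toℕ l) * M fzero l * det N (minor M l)

  det-cong : ∀ N {A B : Mat N} → (∀ i j → A i j ≡ B i j) → det N A ≡ det N B
  det-cong zero    A≗B = refl
  det-cong (suc N) A≗B = sumFin-cong (suc N) λ l →
    cong₂ _*_ (cong (alt (toℕ l) *_) (A≗B fzero l)) (det-cong N (λ i k → A≗B (fsuc i) (punchIn l k)))

  det-linear-column : ∀ N (k : Fin N) (A B C : Mat N) s →
    (∀ i j → j ≢ k → A i j ≡ C i j) → (∀ i j → j ≢ k → B i j ≡ C i j) →
    (∀ i → C i k ≡ A i k + s * B i k) → det N C ≡ det N A + s * det N B
  det-linear-column (suc N) k A B C s A≗C B≗C Cₖ =
    trans (sumFin-cong (suc N) term-linear) (sumFin-linear (suc N) (laplaceTerm A) (laplaceTerm B) s)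
    where
    term-linear : ∀ l → laplaceTerm C l ≡ laplaceTerm A l + s * laplaceTerm B l
    term-linear l with l FP.≟ k
    ... | yes refl = begin
      α * C fzero l * det N (minor C l)                  ≡⟨ cong (λ u → α * u * det N (minor C l)) (Cₖ fzero) ⟩
      α * (A fzero l + s * B fzero l) * det N (minor C l)
        ≡⟨ solve 5 (λ α a s b D → α :* (a :+ s :* b) :* D := α :* a :* D :+ s :* (α :* b :* D)) refl α _ s _ _ ⟩
      α * A fzero l * det N (minor C l) + s * (α * B fzero l * det N (minor C l))
        ≡⟨ cong₂ (λ u v → α * A fzero l * u + s * (α * B fzero l * v))
             (det-cong N (λ i m → sym (A≗C (fsuc i) (punchIn l m) (FP.punchInᵢ≢i l m))))
             (det-cong N (λ i m → sym (B≗C (fsuc i) (punchIn l m) (FP.punchInᵢ≢i l m)))) ⟩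
      laplaceTerm A l + s * laplaceTerm B l              ∎
      where α = alt (toℕ l)
    ... | no l≢k = begin
      α * C fzero l * det N (minor C l)                  ≡⟨ cong (α * C fzero l *_) minor-linear ⟩
      α * C fzero l * (det N (minor A l) + s * det N (minor B l))
        ≡⟨ solve 5 (λ α c D E s → α :* c :* (D :+ s :* E) := α :* c :* D :+ s :* (α :* c :* E)) refl α _ _ _ s ⟩
      α * C fzero l * det N (minor A l) + s * (α * C fzero l * det N (minor B l))
        ≡⟨ cong₂ (λ u v → α * u * det N (minor A l) + s * (α * v * det N (minor B l)))
             (sym (A≗C fzero l l≢k)) (sym (B≗C fzero l l≢k)) ⟩
      laplaceTerm A l + s * laplaceTerm B l              ∎
      where
      α = alt (toℕ l)
      k′ = punchOut l≢k
      punchIn-k′ : punchIn l k′ ≡ k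
      punchIn-k′ = FP.punchIn-punchOut l≢k
      avoids-k : ∀ m → m ≢ k′ → punchIn l m ≢ k
      avoids-k m m≢k′ eq = m≢k′ (FP.punchIn-injective l m k′ (trans eq (sym punchIn-k′)))
      minor-linear : det N (minor C l) ≡ det N (minor A l) + s * det N (minor B l)
      minor-linear = det-linear-column N k′ (minor A l) (minor B l) (minor C l) s
        (λ i m m≢k′ → A≗C (fsuc i) (punchIn l m) (avoids-k m m≢k′))
        (λ i m m≢k′ → B≗C (fsuc i) (punchIn l m) (avoids-k m m≢k′))
        (λ i → subst (λ z → C (fsuc i) z ≡ A (fsuc i) z + s * B (fsuc i) z) (sym punchIn-k′) (Cₖ (fsuc i)))

  det-zero-column : ∀ N (k : Fin N) (C : Mat N) → (∀ i → C i k ≡ 0#) → det N C ≡ 0#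
  det-zero-column N k C Cₖ≡0 = begin
    det N C                        ≡⟨ solve 1 (λ D → D := (D :+ :1 :* D) :- D) refl (det N C) ⟩
    (det N C + 1# * det N C) + - det N C ≡⟨ cong (_+ - det N C) (sym doubled) ⟩
    det N C + - det N C            ≡⟨ solve 1 (λ D → D :- D := :0) refl (det N C) ⟩
    0#                             ∎
    where
    doubled : det N C ≡ det N C + 1# * det N C
    doubled = det-linear-column N k C C C 1# (λ _ _ _ → refl) (λ _ _ _ → refl) λ i → begin
      C i k             ≡⟨ Cₖ≡0 i ⟩
      0#                ≡⟨ solve 0 (:0 := :0 :+ :1 :* :0) refl ⟩
      0# + 1# * 0#      ≡⟨ cong₂ (λ u v → u + 1# * v) (sym (Cₖ≡0 i)) (sym (Cₖ≡0 i)) ⟩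
      C i k + 1# * C i k ∎

  punchIn-inject₁-self : ∀ {N} (q : Fin N) → punchIn (inject₁ q) q ≡ fsuc q
  punchIn-inject₁-self fzero    = refl
  punchIn-inject₁-self (fsuc q) = cong fsuc (punchIn-inject₁-self q)

  punchIn-suc-self : ∀ {N} (q : Fin N) → punchIn (fsuc q) q ≡ inject₁ q
  punchIn-suc-self fzero    = refl
  punchIn-suc-self (fsuc q) = cong fsuc (punchIn-suc-self q)

  punchIn-inject₁≡punchIn-suc : ∀ {N} (q m : Fin N) → m ≢ q → punchIn (inject₁ q) m ≡ punchIn (fsuc q) m
  punchIn-inject₁≡punchIn-suc fzero    fzero    m≢q = ⊥-elim (m≢q refl)
  punchIn-inject₁≡punchIn-suc fzero    (fsuc m) m≢q = refl
  punchIn-inject₁≡punchIn-suc (fsuc q) fzero    m≢q = refl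
  punchIn-inject₁≡punchIn-suc (fsuc q) (fsuc m) m≢q = cong fsuc (punchIn-inject₁≡punchIn-suc q m (m≢q ∘ cong fsuc))

  inject₁≢suc : ∀ {N} (q : Fin N) → inject₁ q ≢ fsuc q
  inject₁≢suc (fsuc q) eq = inject₁≢suc q (FP.suc-injective eq)

  punchIn-adjacentPair : ∀ {N} (l : Fin (suc (suc N))) (q : Fin (suc N)) → l ≢ inject₁ q → l ≢ fsuc q →
    Σ (Fin N) λ q′ → (punchIn l (inject₁ q′) ≡ inject₁ q) × (punchIn l (fsuc q′) ≡ fsuc q)
  punchIn-adjacentPair fzero                  fzero    l≢q l≢q+1 = ⊥-elim (l≢q refl)
  punchIn-adjacentPair fzero                  (fsuc q) l≢q l≢q+1 = q , refl , refl
  punchIn-adjacentPair (fsuc fzero)           fzero    l≢q l≢q+1 = ⊥-elim (l≢q+1 refl)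
  punchIn-adjacentPair {suc N} (fsuc (fsuc l)) fzero   l≢q l≢q+1 = fzero , refl , refl
  punchIn-adjacentPair {suc N} (fsuc l)       (fsuc q) l≢q l≢q+1
    with punchIn-adjacentPair l q (l≢q ∘ cong fsuc) (l≢q+1 ∘ cong fsuc)
  ... | q′ , left , right = fsuc q′ , cong fsuc left , cong fsuc right

  record AdjacentSwap {N} (q : Fin N) (A B : Mat (suc N)) : Set c where
    field
      left  : ∀ i → B i (inject₁ q) ≡ A i (fsuc q)
      right : ∀ i → B i (fsuc q) ≡ A i (inject₁ q)
      other : ∀ i l → l ≢ inject₁ q → l ≢ fsuc q → B i l ≡ A i l

  adjacentSwap-sym : ∀ {N} {q : Fin N} {A B} → AdjacentSwap q A B → AdjacentSwap q B A
  adjacentSwap-sym s = record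
    { left = sym ∘ right ; right = sym ∘ left ; other = λ i l p q → sym (other i l p q) }
    where open AdjacentSwap s

  adjacentSwap-minor : ∀ {N} {q : Fin N} {A B} → AdjacentSwap q A B →
    ∀ i m → minor B (inject₁ q) i m ≡ minor A (fsuc q) i m
  adjacentSwap-minor {q = q} {A} {B} s i m with m FP.≟ q
  ... | yes refl = begin
    B (fsuc i) (punchIn (inject₁ m) m) ≡⟨ cong (B (fsuc i)) (punchIn-inject₁-self m) ⟩
    B (fsuc i) (fsuc m)                ≡⟨ right (fsuc i) ⟩
    A (fsuc i) (inject₁ m)             ≡⟨ cong (A (fsuc i)) (sym (punchIn-suc-self m)) ⟩
    A (fsuc i) (punchIn (fsuc m) m)    ∎
    where open AdjacentSwap s
  ... | no m≢q = begin
    B (fsuc i) (punchIn (inject₁ q) m) ≡⟨ cong (B (fsuc i)) (punchIn-inject₁≡punchIn-suc q m m≢q) ⟩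
    B (fsuc i) (punchIn (fsuc q) m)    ≡⟨ other (fsuc i) _ avoids-q (FP.punchInᵢ≢i (fsuc q) m) ⟩
    A (fsuc i) (punchIn (fsuc q) m)    ∎
    where
    open AdjacentSwap s
    avoids-q : punchIn (fsuc q) m ≢ inject₁ q
    avoids-q eq = FP.punchInᵢ≢i (inject₁ q) m (trans (punchIn-inject₁≡punchIn-suc q m m≢q) eq)

  adjacentSwap-minorOff : ∀ {N} {q : Fin (suc N)} {A B} → AdjacentSwap q A B →
    ∀ l → l ≢ inject₁ q → l ≢ fsuc q → Σ (Fin N) λ q′ → AdjacentSwap q′ (minor A l) (minor B l)
  adjacentSwap-minorOff {q = q} {A} {B} s l l≢q l≢q+1 with punchIn-adjacentPair l q l≢q l≢q+1
  ... | q′ , e₁ , e₂ = q′ , record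
    { left  = λ i → subst₂ (λ u v → B (fsuc i) u ≡ A (fsuc i) v) (sym e₁) (sym e₂) (left (fsuc i))
    ; right = λ i → subst₂ (λ u v → B (fsuc i) u ≡ A (fsuc i) v) (sym e₂) (sym e₁) (right (fsuc i))
    ; other = λ i m m≢q′ m≢q′+1 → other (fsuc i) (punchIn l m)
                (λ eq → m≢q′ (FP.punchIn-injective l m _ (trans eq (sym e₁))))
                (λ eq → m≢q′+1 (FP.punchIn-injective l m _ (trans eq (sym e₂))))
    }
    where open AdjacentSwap s

  laplaceTerm-inject₁ : ∀ {N} (M : Mat (suc (suc N))) (q : Fin (suc N)) →
    laplaceTerm M (inject₁ q) ≡ alt (toℕ q) * M fzero (inject₁ q) * det (suc N) (minor M (inject₁ q))
  laplaceTerm-inject₁ M q = cong (λ n → alt n * M fzero (inject₁ q) * det _ (minor M (inject₁ q))) (FP.toℕ-inject₁ q)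

  det-adjacentSwap : ∀ N (q : Fin N) (A B : Mat (suc N)) → AdjacentSwap q A B → det (suc N) B ≡ - det (suc N) A
  det-adjacentSwap (suc N) q A B s = +≡0⇒≡- (det _ B) (det _ A) (begin
    det _ B + det _ A                    ≡⟨ solve 2 (λ x y → x :+ y := x :+ :1 :* y) refl (det _ B) (det _ A) ⟩
    det _ B + 1# * det _ A               ≡⟨ sym (sumFin-linear _ (laplaceTerm B) (laplaceTerm A) 1#) ⟩
    sumFin _ (λ l → t l)                 ≡⟨ sumFin-pair _ (inject₁ q) (fsuc q) t (inject₁≢suc q) t-off ⟩
    t (inject₁ q) + t (fsuc q)
      ≡⟨ cong₂ (λ u v → (u + 1# * v) + t (fsuc q)) (laplaceTerm-inject₁ B q) (laplaceTerm-inject₁ A q) ⟩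
    (α * B fzero (inject₁ q) * det _ (minor B (inject₁ q)) + 1# * (α * a * D))
      + (- α * B fzero (fsuc q) * det _ (minor B (fsuc q)) + 1# * (- α * a′ * D′))
      ≡⟨ cong₂ (λ u v → (α * u * v + 1# * (α * a * D)) + (- α * B fzero (fsuc q) * det _ (minor B (fsuc q)) + 1# * (- α * a′ * D′)))
           (left fzero) (det-cong _ (adjacentSwap-minor s)) ⟩
    (α * a′ * D′ + 1# * (α * a * D)) + (- α * B fzero (fsuc q) * det _ (minor B (fsuc q)) + 1# * (- α * a′ * D′))
      ≡⟨ cong₂ (λ u v → (α * a′ * D′ + 1# * (α * a * D)) + (- α * u * v + 1# * (- α * a′ * D′)))
           (right fzero) (det-cong _ (λ i m → sym (adjacentSwap-minor (adjacentSwap-sym s) i m))) ⟩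
    (α * a′ * D′ + 1# * (α * a * D)) + (- α * a * D + 1# * (- α * a′ * D′))
      ≡⟨ solve 5 (λ α a D a′ D′ → (α :* a′ :* D′ :+ :1 :* (α :* a :* D)) :+ (:- α :* a :* D :+ :1 :* (:- α :* a′ :* D′))
                                   := :0) refl α a D a′ D′ ⟩
    0#                                   ∎)
    where
    open AdjacentSwap s
    t : Fin (suc (suc N)) → Carrier
    t l = laplaceTerm B l + 1# * laplaceTerm A l
    α = alt (toℕ q)
    a = A fzero (inject₁ q)
    a′ = A fzero (fsuc q)
    D = det (suc N) (minor A (inject₁ q))
    D′ = det (suc N) (minor A (fsuc q))
    t-off : ∀ l → l ≢ inject₁ q → l ≢ fsuc q → t l ≡ 0#
    t-off l l≢q l≢q+1 with adjacentSwap-minorOff s l l≢q l≢q+1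
    ... | q′ , s′ = begin
      alt (toℕ l) * B fzero l * det _ (minor B l) + 1# * laplaceTerm A l
        ≡⟨ cong₂ (λ u v → alt (toℕ l) * u * v + 1# * laplaceTerm A l)
             (other fzero l l≢q l≢q+1) (det-adjacentSwap N q′ (minor A l) (minor B l) s′) ⟩
      alt (toℕ l) * A fzero l * - det _ (minor A l) + 1# * (alt (toℕ l) * A fzero l * det _ (minor A l))
        ≡⟨ solve 3 (λ α a D → α :* a :* (:- D) :+ :1 :* (α :* a :* D) := :0) refl
             (alt (toℕ l)) (A fzero l) (det _ (minor A l)) ⟩
      0# ∎

  -- Not a corollary of det-adjacentSwap, which only yields det A + det A ≡ 0# (useless in characteristic 2).
  det-adjacentEqual : ∀ N (q : Fin N) (A : Mat (suc N)) → AdjacentSwap q A A → det (suc N) A ≡ 0#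
  det-adjacentEqual (suc N) q A s = begin
    sumFin _ (laplaceTerm A)             ≡⟨ sumFin-pair _ (inject₁ q) (fsuc q) (laplaceTerm A) (inject₁≢suc q) t-off ⟩
    laplaceTerm A (inject₁ q) + laplaceTerm A (fsuc q)
      ≡⟨ cong₂ (λ u v → u + - α * a′ * v) (laplaceTerm-inject₁ A q) (det-cong _ (λ i m → sym (adjacentSwap-minor s i m))) ⟩
    α * A fzero (inject₁ q) * D + - α * a′ * D ≡⟨ cong (λ u → α * u * D + - α * a′ * D) (left fzero) ⟩
    α * a′ * D + - α * a′ * D            ≡⟨ solve 3 (λ α a D → α :* a :* D :+ :- α :* a :* D := :0) refl α a′ D ⟩
    0#                                   ∎
    where
    open AdjacentSwap s
    α = alt (toℕ q)
    a′ = A fzero (fsuc q)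
    D = det (suc N) (minor A (inject₁ q))
    t-off : ∀ l → l ≢ inject₁ q → l ≢ fsuc q → laplaceTerm A l ≡ 0#
    t-off l l≢q l≢q+1 with adjacentSwap-minorOff s l l≢q l≢q+1
    ... | q′ , s′ = begin
      alt (toℕ l) * A fzero l * det _ (minor A l)
        ≡⟨ cong (alt (toℕ l) * A fzero l *_) (det-adjacentEqual N q′ (minor A l) s′) ⟩
      alt (toℕ l) * A fzero l * 0#
        ≡⟨ solve 2 (λ α a → α :* a :* :0 := :0) refl (alt (toℕ l)) (A fzero l) ⟩
      0# ∎

  swapAdjacent : ∀ {N} → Mat (suc N) → Fin N → Mat (suc N)
  swapAdjacent A q i l with l FP.≟ inject₁ q | l FP.≟ fsuc q
  ... | yes _ | _     = A i (fsuc q)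
  ... | no _  | yes _ = A i (inject₁ q)
  ... | no _  | no _  = A i l

  swapAdjacent-adjacentSwap : ∀ {N} (A : Mat (suc N)) q → AdjacentSwap q A (swapAdjacent A q)
  swapAdjacent-adjacentSwap A q = record { left = left ; right = right ; other = other }
    where
    left : ∀ i → swapAdjacent A q i (inject₁ q) ≡ A i (fsuc q)
    left i with inject₁ q FP.≟ inject₁ q
    ... | yes _  = refl
    ... | no q≢q = ⊥-elim (q≢q refl)
    right : ∀ i → swapAdjacent A q i (fsuc q) ≡ A i (inject₁ q)
    right i with fsuc q FP.≟ inject₁ q | fsuc q FP.≟ fsuc q
    ... | yes eq | _        = ⊥-elim (inject₁≢suc q (sym eq))
    ... | no _   | yes _    = refl
    ... | no _   | no q≢q   = ⊥-elim (q≢q refl)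
    other : ∀ i l → l ≢ inject₁ q → l ≢ fsuc q → swapAdjacent A q i l ≡ A i l
    other i l l≢q l≢q+1 with l FP.≟ inject₁ q | l FP.≟ fsuc q
    ... | yes eq | _      = ⊥-elim (l≢q eq)
    ... | no _   | yes eq = ⊥-elim (l≢q+1 eq)
    ... | no _   | no _   = refl

  -- Swapping columns q and q + 1 moves the copy of column j, sitting at q + 1, one step closer to j.
  det-equalColumns-≤ : ∀ n N (A : Mat (suc N)) (j : Fin (suc N)) (q : Fin N) → toℕ q ≡ n → toℕ j ℕ.≤ n →
    (∀ i → A i j ≡ A i (fsuc q)) → det (suc N) A ≡ 0#
  det-equalColumns-≤ n N A j q q≡n j≤n Aⱼ≡Aₖ with ℕP.m≤n⇒m<n∨m≡n j≤n
  ... | inj₂ j≡n = det-adjacentEqual N q A record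
    { left  = λ i → subst (λ l → A i l ≡ A i (fsuc q)) j≡q (Aⱼ≡Aₖ i)
    ; right = λ i → sym (subst (λ l → A i l ≡ A i (fsuc q)) j≡q (Aⱼ≡Aₖ i))
    ; other = λ _ _ _ _ → refl }
    where
    j≡q : j ≡ inject₁ q
    j≡q = FP.toℕ-injective (trans j≡n (trans (sym q≡n) (sym (FP.toℕ-inject₁ q))))
  det-equalColumns-≤ (suc n) (suc N) A j (fsuc q₀) q≡n j≤n Aⱼ≡Aₖ | inj₁ (s≤s j≤n′) = begin
    det _ A            ≡⟨ solve 1 (λ x → x := :- (:- x)) refl (det _ A) ⟩
    - (- det _ A)      ≡⟨ cong -_ (sym (det-adjacentSwap _ q A A′ swapped)) ⟩
    - det _ A′         ≡⟨ cong -_ A′-singular ⟩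
    - 0#               ≡⟨ solve 0 (:- :0 := :0) refl ⟩
    0#                 ∎
    where
    q = fsuc q₀
    A′ = swapAdjacent A q
    swapped = swapAdjacent-adjacentSwap A q
    q₀≡n : toℕ (inject₁ q₀) ≡ n
    q₀≡n = trans (FP.toℕ-inject₁ q₀) (ℕP.suc-injective q≡n)
    j<q : toℕ j ℕ.< toℕ q
    j<q = subst (toℕ j ℕ.<_) (sym q≡n) (s≤s j≤n′)
    j∉pair : ∀ i → A′ i j ≡ A i j
    j∉pair i = AdjacentSwap.other swapped i j
      (λ eq → ℕP.<-irrefl (trans (cong toℕ eq) (FP.toℕ-inject₁ q)) j<q)
      (λ eq → ℕP.<-irrefl (cong toℕ eq) (ℕP.m<n⇒m<1+n j<q))
    A′-singular : det _ A′ ≡ 0#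
    A′-singular = det-equalColumns-≤ n (suc N) A′ j (inject₁ q₀) q₀≡n j≤n′
      (λ i → trans (j∉pair i) (trans (Aⱼ≡Aₖ i) (sym (AdjacentSwap.left swapped i))))

  det-equalColumns-< : ∀ N (A : Mat (suc N)) (j k : Fin (suc N)) → toℕ j ℕ.< toℕ k →
    (∀ i → A i j ≡ A i k) → det (suc N) A ≡ 0#
  det-equalColumns-< N A j (fsuc q) (s≤s j≤q) = det-equalColumns-≤ (toℕ q) N A j q refl j≤q

  det-equalColumns : ∀ N (A : Mat N) (j k : Fin N) → j ≢ k → (∀ i → A i j ≡ A i k) → det N A ≡ 0#
  det-equalColumns (suc N) A j k j≢k Aⱼ≡Aₖ with ℕP.<-cmp (toℕ j) (toℕ k)
  ... | tri< j<k _ _ = det-equalColumns-< N A j k j<k Aⱼ≡Aₖ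
  ... | tri≈ _ j≡k _ = ⊥-elim (j≢k (FP.toℕ-injective j≡k))
  ... | tri> _ _ k<j = det-equalColumns-< N A k j k<j (sym ∘ Aⱼ≡Aₖ)

  setColumn : ∀ {N} → Mat N → Fin N → (Fin N → Carrier) → Mat N
  setColumn M k v i j with j FP.≟ k
  ... | yes _ = v i
  ... | no _  = M i j

  setColumn-at : ∀ {N} (M : Mat N) k v i → setColumn M k v i k ≡ v i
  setColumn-at M k v i with k FP.≟ k
  ... | yes _  = refl
  ... | no k≢k = ⊥-elim (k≢k refl)

  setColumn-off : ∀ {N} (M : Mat N) k v i j → j ≢ k → setColumn M k v i j ≡ M i j
  setColumn-off M k v i j j≢k with j FP.≟ k
  ... | yes j≡k = ⊥-elim (j≢k j≡k)
  ... | no _    = refl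

  setColumn-self : ∀ {N} (M : Mat N) k i j → setColumn M k (λ i′ → M i′ k) i j ≡ M i j
  setColumn-self M k i j with j FP.≟ k
  ... | yes refl = refl
  ... | no _     = refl

  det-column-sum : ∀ N (k : Fin N) (M C : Mat N) m (U : Fin m → Fin N → Carrier) (w : Fin m → Carrier) →
    (∀ i j → j ≢ k → C i j ≡ M i j) → (∀ i → C i k ≡ sumFin m (λ l → w l * U l i)) →
    det N C ≡ sumFin m (λ l → w l * det N (setColumn M k (U l)))
  det-column-sum N k M C zero    U w C≗M Cₖ = det-zero-column N k C Cₖ
  det-column-sum N k M C (suc m) U w C≗M Cₖ = begin
    det N C                     ≡⟨ det-linear-column N k A B C (w fzero) agrees agrees Cₖ-split ⟩
    det N A + w fzero * det N B
      ≡⟨ cong (_+ w fzero * det N B) (det-column-sum N k M A m (U ∘ fsuc) (w ∘ fsuc) (setColumn-off M k _)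
                                                                                   (setColumn-at M k _)) ⟩
    S + w fzero * det N B       ≡⟨ solve 2 (λ x y → x :+ y := y :+ x) refl S (w fzero * det N B) ⟩
    w fzero * det N B + S       ∎
    where
    A = setColumn M k (λ i → sumFin m (λ l → w (fsuc l) * U (fsuc l) i))
    B = setColumn M k (U fzero)
    S = sumFin m (λ l → w (fsuc l) * det N (setColumn M k (U (fsuc l))))
    agrees : ∀ {v} i j → j ≢ k → setColumn M k v i j ≡ C i j
    agrees i j j≢k = trans (setColumn-off M k _ i j j≢k) (sym (C≗M i j j≢k))
    Cₖ-split : ∀ i → C i k ≡ A i k + w fzero * B i k
    Cₖ-split i = begin
      C i k                                                     ≡⟨ Cₖ i ⟩
      w fzero * U fzero i + sumFin m (λ l → w (fsuc l) * U (fsuc l) i)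
        ≡⟨ solve 2 (λ x y → x :+ y := y :+ x) refl (w fzero * U fzero i) _ ⟩
      sumFin m (λ l → w (fsuc l) * U (fsuc l) i) + w fzero * U fzero i
        ≡⟨ cong₂ (λ u v → u + w fzero * v) (sym (setColumn-at M k _ i)) (sym (setColumn-at M k _ i)) ⟩
      A i k + w fzero * B i k                                   ∎

  det-column-combination : ∀ N (k : Fin N) (M C : Mat N) (t : Fin N → Carrier) →
    (∀ i j → j ≢ k → C i j ≡ M i j) → (∀ i → C i k ≡ sumFin N (λ j → t j * M i j)) →
    det N C ≡ t k * det N M
  det-column-combination N k M C t C≗M Cₖ = begin
    det N C                                              ≡⟨ det-column-sum N k M C N (λ j i → M i j) t C≗M Cₖ ⟩
    sumFin N (λ j → t j * det N (setColumn M k (λ i → M i j))) ≡⟨ sumFin-single N k _ repeated-column ⟩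
    t k * det N (setColumn M k (λ i → M i k))           ≡⟨ cong (t k *_) (det-cong N (setColumn-self M k)) ⟩
    t k * det N M                                        ∎
    where
    repeated-column : ∀ j → j ≢ k → t j * det N (setColumn M k (λ i → M i j)) ≡ 0#
    repeated-column j j≢k = begin
      t j * det N (setColumn M k (λ i → M i j))
        ≡⟨ cong (t j *_) (det-equalColumns N _ j k j≢k λ i → trans (setColumn-off M k _ i j j≢k) (sym (setColumn-at M k _ i))) ⟩
      t j * 0#  ≡⟨ solve 1 (λ x → x :* :0 := :0) refl (t j) ⟩
      0#        ∎

  det-lowerTriangular : ∀ n (M : Mat (suc n)) → (∀ i j → toℕ i ℕ.< toℕ j → M i j ≡ 0#) →
    (∀ i → toℕ i ℕ.< n → M i i ≡ 1#) → det (suc n) M ≡ M (fromℕ n) (fromℕ n)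
  det-lowerTriangular zero    M upper≡0 diag≡1 = solve 1 (λ x → :1 :* x :* :1 :+ :0 := x) refl (M fzero fzero)
  det-lowerTriangular (suc n) M upper≡0 diag≡1 = begin
    laplaceTerm M fzero + sumFin (suc n) (laplaceTerm M ∘ fsuc)
      ≡⟨ cong₂ _+_ (cong₂ (λ u v → 1# * u * v) (diag≡1 fzero (s≤s z≤n)) minor₀) (sumFin-zero (suc n) _ first-row-zero) ⟩
    1# * 1# * M (fromℕ (suc n)) (fromℕ (suc n)) + 0#
      ≡⟨ solve 1 (λ x → :1 :* :1 :* x :+ :0 := x) refl _ ⟩
    M (fromℕ (suc n)) (fromℕ (suc n)) ∎
    where
    minor₀ : det (suc n) (minor M fzero) ≡ M (fromℕ (suc n)) (fromℕ (suc n))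
    minor₀ = det-lowerTriangular n (minor M fzero)
      (λ i j i<j → upper≡0 (fsuc i) (fsuc j) (s≤s i<j)) (λ i i<n → diag≡1 (fsuc i) (s≤s i<n))
    first-row-zero : ∀ l → laplaceTerm M (fsuc l) ≡ 0#
    first-row-zero l = begin
      alt (suc (toℕ l)) * M fzero (fsuc l) * det (suc n) (minor M (fsuc l))
        ≡⟨ cong (λ u → alt (suc (toℕ l)) * u * det (suc n) (minor M (fsuc l))) (upper≡0 fzero (fsuc l) (s≤s z≤n)) ⟩
      alt (suc (toℕ l)) * 0# * det (suc n) (minor M (fsuc l))
        ≡⟨ solve 2 (λ α D → α :* :0 :* D := :0) refl (alt (suc (toℕ l))) _ ⟩
      0# ∎

  diagonalProduct : (ℕ → ℕ → Carrier) → ℕ → ℕ → Carrier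
  diagonalProduct T s zero    = 1#
  diagonalProduct T s (suc r) = T s s * diagonalProduct T (suc s) r

  -- Sweeps left to right: mixed s has the columns of A before position s and those of G from s on,
  -- and replacing column s of G by column s of A divides the determinant by T s s.
  module ColumnSweep {N} (A G : Mat N) (T : ℕ → ℕ → Carrier) (T-upper : ∀ j k → k ℕ.< j → T j k ≡ 0#)
                     (G≡AT : ∀ i k → G i k ≡ sumFin N (λ j → T (toℕ j) (toℕ k) * A i j)) where

    mixed : ℕ → Mat N
    mixed s i j with toℕ j ℕ.<? s
    ... | yes _ = A i j
    ... | no _  = G i j

    mixed-< : ∀ s i j → toℕ j ℕ.< s → mixed s i j ≡ A i j
    mixed-< s i j j<s with toℕ j ℕ.<? s
    ... | yes _   = refl
    ... | no j≮s = ⊥-elim (j≮s j<s)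

    mixed-≥ : ∀ s i j → s ℕ.≤ toℕ j → mixed s i j ≡ G i j
    mixed-≥ s i j s≤j with toℕ j ℕ.<? s
    ... | yes j<s = ⊥-elim (ℕP.<⇒≱ j<s s≤j)
    ... | no _    = refl

    mixed-suc : ∀ s i j → toℕ j ≢ s → mixed s i j ≡ mixed (suc s) i j
    mixed-suc s i j j≢s with toℕ j ℕ.<? s | toℕ j ℕ.<? suc s
    ... | yes _   | yes _         = refl
    ... | no _    | no _          = refl
    ... | yes j<s | no j≮s+1      = ⊥-elim (j≮s+1 (ℕP.m<n⇒m<1+n j<s))
    ... | no j≮s  | yes (s≤s j≤s) = ⊥-elim (j≢s (ℕP.≤-antisym j≤s (ℕP.≮⇒≥ j≮s)))

    det-mixed-suc : ∀ s → s ℕ.< N → det N (mixed s) ≡ T s s * det N (mixed (suc s))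
    det-mixed-suc s s<N = begin
      det N (mixed s)                      ≡⟨ det-column-combination N k (mixed (suc s)) (mixed s) (λ j → T (toℕ j) s) off-k at-k ⟩
      T (toℕ k) s * det N (mixed (suc s))  ≡⟨ cong (λ u → T u s * det N (mixed (suc s))) k≡s ⟩
      T s s * det N (mixed (suc s))        ∎
      where
      k = fromℕ< s<N
      k≡s : toℕ k ≡ s
      k≡s = FP.toℕ-fromℕ< s<N
      off-k : ∀ i j → j ≢ k → mixed s i j ≡ mixed (suc s) i j
      off-k i j j≢k = mixed-suc s i j (λ j≡s → j≢k (FP.toℕ-injective (trans j≡s (sym k≡s))))
      at-k : ∀ i → mixed s i k ≡ sumFin N (λ j → T (toℕ j) s * mixed (suc s) i j)
      at-k i = begin
        mixed s i k                                       ≡⟨ mixed-≥ s i k (ℕP.≤-reflexive (sym k≡s)) ⟩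
        G i k                                             ≡⟨ G≡AT i k ⟩
        sumFin N (λ j → T (toℕ j) (toℕ k) * A i j)        ≡⟨ sumFin-cong N term ⟩
        sumFin N (λ j → T (toℕ j) s * mixed (suc s) i j)  ∎
        where
        term : ∀ j → T (toℕ j) (toℕ k) * A i j ≡ T (toℕ j) s * mixed (suc s) i j
        term j rewrite k≡s with ℕP.<-≤-connex (toℕ j) (suc s)
        ... | inj₁ j<s+1 = cong (T (toℕ j) s *_) (sym (mixed-< (suc s) i j j<s+1))
        ... | inj₂ s<j = begin
          T (toℕ j) s * A i j             ≡⟨ cong (_* A i j) (T-upper (toℕ j) s s<j) ⟩
          0# * A i j                      ≡⟨ solve 2 (λ a g → :0 :* a := :0 :* g) refl (A i j) (mixed (suc s) i j) ⟩
          0# * mixed (suc s) i j          ≡⟨ cong (_* mixed (suc s) i j) (sym (T-upper (toℕ j) s s<j)) ⟩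
          T (toℕ j) s * mixed (suc s) i j ∎

    det-mixed : ∀ r s → s ℕ.+ r ≡ N → det N (mixed s) ≡ diagonalProduct T s r * det N A
    det-mixed zero s s+0≡N = begin
      det N (mixed s) ≡⟨ det-cong N (λ i j → mixed-< s i j (subst (toℕ j ℕ.<_) (sym s≡N) (FP.toℕ<n j))) ⟩
      det N A         ≡⟨ solve 1 (λ x → x := :1 :* x) refl (det N A) ⟩
      1# * det N A    ∎
      where
      s≡N : s ≡ N
      s≡N = trans (sym (ℕP.+-identityʳ s)) s+0≡N
    det-mixed (suc r) s s+r+1≡N = begin
      det N (mixed s)                                    ≡⟨ det-mixed-suc s (subst (s ℕ.<_) s+r+1≡N (ℕP.m<m+n s (s≤s z≤n))) ⟩
      T s s * det N (mixed (suc s))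
        ≡⟨ cong (T s s *_) (det-mixed r (suc s) (trans (sym (ℕP.+-suc s r)) s+r+1≡N)) ⟩
      T s s * (diagonalProduct T (suc s) r * det N A)
        ≡⟨ solve 3 (λ a b c → a :* (b :* c) := a :* b :* c) refl (T s s) _ (det N A) ⟩
      diagonalProduct T s (suc r) * det N A              ∎

  det-upperTriangularCombination : ∀ N (A G : Mat N) (T : ℕ → ℕ → Carrier) → (∀ j k → k ℕ.< j → T j k ≡ 0#) →
    (∀ i k → G i k ≡ sumFin N (λ j → T (toℕ j) (toℕ k) * A i j)) →
    det N G ≡ diagonalProduct T 0 N * det N A
  det-upperTriangularCombination N A G T T-upper G≡AT = begin
    det N G                          ≡⟨ det-cong N (λ i j → sym (mixed-≥ 0 i j z≤n)) ⟩
    det N (mixed 0)                  ≡⟨ det-mixed N 0 refl ⟩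
    diagonalProduct T 0 N * det N A  ∎
    where open ColumnSweep A G T T-upper G≡AT

module PolynomialLemmas {c : Level} (F : Field c) where
  open Field F
  open Setup F
  open FieldSolver F
  open ≡-Reasoning

  evalP-addP : ∀ p q x → evalP (addP p q) x ≡ evalP p x + evalP q x
  evalP-addP []      q       x = solve 1 (λ y → y := :0 :+ y) refl (evalP q x)
  evalP-addP (u ∷ p) []      x = solve 1 (λ y → y := y :+ :0) refl (evalP (u ∷ p) x)
  evalP-addP (u ∷ p) (v ∷ q) x = begin
    (u + v) + x * evalP (addP p q) x             ≡⟨ cong (λ z → (u + v) + x * z) (evalP-addP p q x) ⟩
    (u + v) + x * (evalP p x + evalP q x)
      ≡⟨ solve 5 (λ u v x A B → (u :+ v) :+ x :* (A :+ B) := (u :+ x :* A) :+ (v :+ x :* B)) refl u v x (evalP p x) (evalP q x) ⟩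
    (u + x * evalP p x) + (v + x * evalP q x)    ∎

  evalP-scaleP : ∀ k p x → evalP (scaleP k p) x ≡ k * evalP p x
  evalP-scaleP k []      x = solve 1 (λ k → :0 := k :* :0) refl k
  evalP-scaleP k (u ∷ p) x = begin
    k * u + x * evalP (scaleP k p) x ≡⟨ cong (λ z → k * u + x * z) (evalP-scaleP k p x) ⟩
    k * u + x * (k * evalP p x)      ≡⟨ solve 4 (λ k u x A → k :* u :+ x :* (k :* A) := k :* (u :+ x :* A)) refl k u x (evalP p x) ⟩
    k * (u + x * evalP p x)          ∎

  evalP-monomial : ∀ k x → evalP (monomial k) x ≡ x ^ k
  evalP-monomial zero    x = solve 1 (λ x → :1 :+ x :* :0 := :1) refl x
  evalP-monomial (suc k) x = begin
    0# + x * evalP (monomial k) x ≡⟨ cong (λ z → 0# + x * z) (evalP-monomial k x) ⟩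
    0# + x * x ^ k                ≡⟨ solve 2 (λ x z → :0 :+ x :* z := x :* z) refl x (x ^ k) ⟩
    x * x ^ k                     ∎

  length-monomial : ∀ k → length (monomial k) ≡ suc k
  length-monomial zero    = refl
  length-monomial (suc k) = cong suc (length-monomial k)

  length-addP : ∀ K p q → length p ℕ.≤ K → length q ℕ.≤ K → length (addP p q) ℕ.≤ K
  length-addP K       []      q       _         q≤K       = q≤K
  length-addP K       (u ∷ p) []      p≤K       _         = p≤K
  length-addP (suc K) (u ∷ p) (v ∷ q) (s≤s p≤K) (s≤s q≤K) = s≤s (length-addP K p q p≤K q≤K)

  length-scaleP : ∀ k p → length (scaleP k p) ≡ length p
  length-scaleP k = LP.length-map (k *_)

  divByLinear : Carrier → Poly → Poly
  divByLinear r []          = []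
  divByLinear r (u ∷ [])    = []
  divByLinear r (u ∷ v ∷ p) = evalP (v ∷ p) r ∷ divByLinear r (v ∷ p)

  length-divByLinear : ∀ r p → length (divByLinear r p) ≡ ℕ.pred (length p)
  length-divByLinear r []          = refl
  length-divByLinear r (u ∷ [])    = refl
  length-divByLinear r (u ∷ v ∷ p) = cong suc (length-divByLinear r (v ∷ p))

  evalP-divByLinear : ∀ r p x → evalP p x ≡ (x + - r) * evalP (divByLinear r p) x + evalP p r
  evalP-divByLinear r []          x = solve 2 (λ x r → :0 := (x :- r) :* :0 :+ :0) refl x r
  evalP-divByLinear r (u ∷ [])    x = solve 3 (λ u x r → u :+ x :* :0 := (x :- r) :* :0 :+ (u :+ r :* :0)) refl u x r
  evalP-divByLinear r (u ∷ v ∷ p) x = begin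
    u + x * evalP (v ∷ p) x
      ≡⟨ cong (λ z → u + x * z) (evalP-divByLinear r (v ∷ p) x) ⟩
    u + x * ((x + - r) * evalP (divByLinear r (v ∷ p)) x + evalP (v ∷ p) r)
      ≡⟨ solve 5 (λ u x r Q R → u :+ x :* ((x :- r) :* Q :+ R) := (x :- r) :* (R :+ x :* Q) :+ (u :+ r :* R)) refl
           u x r (evalP (divByLinear r (v ∷ p)) x) (evalP (v ∷ p) r) ⟩
    (x + - r) * evalP (divByLinear r (u ∷ v ∷ p)) x + evalP (u ∷ v ∷ p) r ∎

module Moments {c : Level} (F : Field c) (a lam : ℕ → Field.Carrier F)
  (L : ℕ → Setup.Poly F → Field.Carrier F) (linear : Setup.IsLinearOnV F a lam L) where
  open Field F
  open Setup F
  open FieldSolver F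
  open IsLinearOnV linear
  open ≡-Reasoning

  -- moment m s p = 𝓛(x^s p(x) / d_m(x)), computed coefficientwise from the ν's so that it is
  -- additive on the nose (addP and shiftN do not commute up to ≡).
  moment : ℕ → ℕ → Poly → Carrier
  moment m s []      = 0#
  moment m s (u ∷ p) = u * ν L s m + moment m (suc s) p

  L-shiftN : ∀ m s p → L m (shiftN s p) ≡ moment m s p
  L-shiftN m s []      = begin
    L m (shiftN s [])              ≡⟨ cong (L m) (shiftN-nil s) ⟩
    L m (scaleP 0# (shiftN s []))  ≡⟨ homogeneous m 0# _ ⟩
    0# * L m (shiftN s [])         ≡⟨ solve 1 (λ x → :0 :* x := :0) refl _ ⟩
    0#                             ∎
    where
    shiftN-nil : ∀ s → shiftN s [] ≡ scaleP 0# (shiftN s [])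
    shiftN-nil zero    = refl
    shiftN-nil (suc s) = cong₂ _∷_ (solve 0 (:0 := :0 :* :0) refl) (shiftN-nil s)
  L-shiftN m s (u ∷ p) = begin
    L m (shiftN s (u ∷ p))                                        ≡⟨ cong (L m) (shiftN-cons s) ⟩
    L m (addP (scaleP u (monomial s)) (shiftN (suc s) p))         ≡⟨ additive m _ _ ⟩
    L m (scaleP u (monomial s)) + L m (shiftN (suc s) p)          ≡⟨ cong₂ _+_ (homogeneous m u _) (L-shiftN m (suc s) p) ⟩
    u * ν L s m + moment m (suc s) p                              ∎
    where
    shiftN-cons : ∀ s → shiftN s (u ∷ p) ≡ addP (scaleP u (monomial s)) (shiftN (suc s) p)
    shiftN-cons zero    = cong (_∷ p) (solve 1 (λ u → u := u :* :1 :+ :0) refl u)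
    shiftN-cons (suc s) = cong₂ _∷_ (solve 1 (λ u → :0 := u :* :0 :+ :0) refl u) (shiftN-cons s)

  moment-addP : ∀ m s p q → moment m s (addP p q) ≡ moment m s p + moment m s q
  moment-addP m s []      q       = solve 1 (λ x → x := :0 :+ x) refl (moment m s q)
  moment-addP m s (u ∷ p) []      = solve 1 (λ x → x := x :+ :0) refl (moment m s (u ∷ p))
  moment-addP m s (u ∷ p) (v ∷ q) = begin
    (u + v) * ν L s m + moment m (suc s) (addP p q)
      ≡⟨ cong ((u + v) * ν L s m +_) (moment-addP m (suc s) p q) ⟩
    (u + v) * ν L s m + (moment m (suc s) p + moment m (suc s) q)
      ≡⟨ solve 5 (λ u v n A B → (u :+ v) :* n :+ (A :+ B) := (u :* n :+ A) :+ (v :* n :+ B)) refl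
           u v (ν L s m) (moment m (suc s) p) (moment m (suc s) q) ⟩
    (u * ν L s m + moment m (suc s) p) + (v * ν L s m + moment m (suc s) q) ∎

  moment-scaleP : ∀ m s k p → moment m s (scaleP k p) ≡ k * moment m s p
  moment-scaleP m s k []      = solve 1 (λ k → :0 := k :* :0) refl k
  moment-scaleP m s k (u ∷ p) = begin
    k * u * ν L s m + moment m (suc s) (scaleP k p) ≡⟨ cong (k * u * ν L s m +_) (moment-scaleP m (suc s) k p) ⟩
    k * u * ν L s m + k * moment m (suc s) p
      ≡⟨ solve 4 (λ k u n A → k :* u :* n :+ k :* A := k :* (u :* n :+ A)) refl k u (ν L s m) (moment m (suc s) p) ⟩
    k * (u * ν L s m + moment m (suc s) p)          ∎

  moment-shiftP : ∀ m s p → moment m s (shiftP p) ≡ moment m (suc s) p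
  moment-shiftP m s p = solve 2 (λ n A → :0 :* n :+ A := A) refl (ν L s m) (moment m (suc s) p)

  moment-linP : ∀ m s α β p → moment m s (linP α β p) ≡ α * moment m (suc s) p + β * moment m s p
  moment-linP m s α β p = begin
    moment m s (linP α β p)                                       ≡⟨ moment-addP m s (scaleP α (shiftP p)) (scaleP β p) ⟩
    moment m s (scaleP α (shiftP p)) + moment m s (scaleP β p)
      ≡⟨ cong₂ _+_ (moment-scaleP m s α (shiftP p)) (moment-scaleP m s β p) ⟩
    α * moment m s (shiftP p) + β * moment m s p                  ≡⟨ cong (λ z → α * z + β * moment m s p) (moment-shiftP m s p) ⟩
    α * moment m (suc s) p + β * moment m s p                     ∎

  ν-compatible : ∀ s m → ν L s m ≡ a (suc m) * ν L (suc s) (suc m) + lam (suc m) * ν L s (suc m)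
  ν-compatible s m = begin
    L m (monomial s)                                              ≡⟨ sym (compatible m (monomial s)) ⟩
    L (suc m) (linP (a (suc m)) (lam (suc m)) (monomial s))       ≡⟨ additive (suc m) _ _ ⟩
    L (suc m) (scaleP (a (suc m)) (monomial (suc s))) + L (suc m) (scaleP (lam (suc m)) (monomial s))
      ≡⟨ cong₂ _+_ (homogeneous (suc m) _ _) (homogeneous (suc m) _ _) ⟩
    a (suc m) * ν L (suc s) (suc m) + lam (suc m) * ν L s (suc m) ∎

  moment-compatible : ∀ m s p → moment m s p ≡ a (suc m) * moment (suc m) (suc s) p + lam (suc m) * moment (suc m) s p
  moment-compatible m s []      = solve 2 (λ α β → :0 := α :* :0 :+ β :* :0) refl (a (suc m)) (lam (suc m))
  moment-compatible m s (u ∷ p) = begin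
    u * ν L s m + moment m (suc s) p
      ≡⟨ cong₂ (λ v w → u * v + w) (ν-compatible s m) (moment-compatible m (suc s) p) ⟩
    u * (α * ν L (suc s) (suc m) + β * ν L s (suc m)) + (α * moment (suc m) (suc (suc s)) p + β * moment (suc m) (suc s) p)
      ≡⟨ solve 7 (λ u α β n₁ n₀ A B → u :* (α :* n₁ :+ β :* n₀) :+ (α :* A :+ β :* B)
                                     := α :* (u :* n₁ :+ A) :+ β :* (u :* n₀ :+ B)) refl
           u α β (ν L (suc s) (suc m)) (ν L s (suc m)) (moment (suc m) (suc (suc s)) p) (moment (suc m) (suc s) p) ⟩
    α * (u * ν L (suc s) (suc m) + moment (suc m) (suc (suc s)) p) + β * (u * ν L s (suc m) + moment (suc m) (suc s) p) ∎
    where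
    α = a (suc m)
    β = lam (suc m)

  moment-monomial : ∀ m s k → moment m s (monomial k) ≡ ν L (s ℕ.+ k) m
  moment-monomial m s zero    = begin
    1# * ν L s m + 0#  ≡⟨ solve 1 (λ v → :1 :* v :+ :0 := v) refl (ν L s m) ⟩
    ν L s m            ≡⟨ cong (λ n → ν L n m) (sym (ℕP.+-identityʳ s)) ⟩
    ν L (s ℕ.+ 0) m    ∎
  moment-monomial m s (suc k) = begin
    moment m s (monomial (suc k))   ≡⟨ moment-shiftP m s (monomial k) ⟩
    moment m (suc s) (monomial k)   ≡⟨ moment-monomial m (suc s) k ⟩
    ν L (suc s ℕ.+ k) m             ≡⟨ cong (λ n → ν L n m) (sym (ℕP.+-suc s k)) ⟩
    ν L (s ℕ.+ suc k) m             ∎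

module OrthogonalPolynomials {c : Level} (F : Field c) (b a lam : ℕ → Field.Carrier F)
  (L : ℕ → Setup.Poly F → Field.Carrier F) (isMoment : Setup.IsMomentFunctional F b a lam L) where
  open Field F
  open Setup F
  open FieldSolver F
  open PolynomialLemmas F
  open IsMomentFunctional isMoment
  open Moments F a lam L linear
  open ≡-Reasoning

  length-PP : ∀ k → length (proj₁ (PP b a lam k)) ℕ.≤ k × length (P b a lam k) ℕ.≤ suc k
  length-PP zero    = z≤n , s≤s z≤n
  length-PP (suc k) with length-PP k
  ... | prev≤k , Pₖ≤k+1 = Pₖ≤k+1 ,
    length-addP K (addP (shiftP Pₖ) (scaleP (- b k) Pₖ)) (scaleP (- 1#) (linP (a k) (lam k) Pₖ₋₁))
      (length-addP K (shiftP Pₖ) (scaleP (- b k) Pₖ) (s≤s Pₖ≤k+1) (scaled (- b k) Pₖ (ℕP.m≤n⇒m≤1+n Pₖ≤k+1)))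
      (scaled (- 1#) (linP (a k) (lam k) Pₖ₋₁)
        (length-addP K (scaleP (a k) (shiftP Pₖ₋₁)) (scaleP (lam k) Pₖ₋₁)
          (scaled (a k) (shiftP Pₖ₋₁) (s≤s (ℕP.m≤n⇒m≤1+n prev≤k)))
          (scaled (lam k) Pₖ₋₁ (ℕP.m≤n⇒m≤1+n (ℕP.m≤n⇒m≤1+n prev≤k)))))
    where
    K = suc (suc k)
    Pₖ = P b a lam k
    Pₖ₋₁ = proj₁ (PP b a lam k)
    scaled : ∀ u p → length p ℕ.≤ K → length (scaleP u p) ℕ.≤ K
    scaled u p = subst (ℕ._≤ K) (sym (length-scaleP u p))

  length-P : ∀ k → length (P b a lam k) ℕ.≤ suc k
  length-P k = proj₂ (length-PP k)

  moment-orthogonal : ∀ k i → i ℕ.< k → moment k i (P b a lam k) ≡ 0#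
  moment-orthogonal k i i<k = trans (sym (L-shiftN k i (P b a lam k))) (orthogonal k i i<k)

  moment-recurrence : ∀ m s n → moment m s (P b a lam (suc n)) ≡
    moment m (suc s) (P b a lam n) + - b n * moment m s (P b a lam n)
      + - 1# * moment m s (linP (a n) (lam n) (proj₁ (PP b a lam n)))
  moment-recurrence m s n = begin
    moment m s (addP (addP (shiftP Pₙ) (scaleP (- b n) Pₙ)) (scaleP (- 1#) ℓPₙ₋₁))
      ≡⟨ moment-addP m s (addP (shiftP Pₙ) (scaleP (- b n) Pₙ)) (scaleP (- 1#) ℓPₙ₋₁) ⟩
    moment m s (addP (shiftP Pₙ) (scaleP (- b n) Pₙ)) + moment m s (scaleP (- 1#) ℓPₙ₋₁)
      ≡⟨ cong₂ _+_ (moment-addP m s (shiftP Pₙ) (scaleP (- b n) Pₙ)) (moment-scaleP m s (- 1#) ℓPₙ₋₁) ⟩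
    moment m s (shiftP Pₙ) + moment m s (scaleP (- b n) Pₙ) + - 1# * moment m s ℓPₙ₋₁
      ≡⟨ cong₂ (λ u v → u + v + - 1# * moment m s ℓPₙ₋₁) (moment-shiftP m s Pₙ) (moment-scaleP m s (- b n) Pₙ) ⟩
    moment m (suc s) Pₙ + - b n * moment m s Pₙ + - 1# * moment m s ℓPₙ₋₁ ∎
    where
    Pₙ = P b a lam n
    Pₙ₋₁ = proj₁ (PP b a lam n)
    ℓPₙ₋₁ = linP (a n) (lam n) Pₙ₋₁

  moment-diagonal : ∀ k → moment k k (P b a lam k) ≡ 1#
  moment-diagonal zero    = trans (solve 1 (λ n → :1 :* n :+ :0 := n) refl (ν L 0 0)) normalised
  moment-diagonal (suc k) = trans step (moment-diagonal k)
    where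
    Pₖ = P b a lam k
    Pₖ₊₁ = P b a lam (suc k)
    Pₖ₊₂ = P b a lam (suc (suc k))
    M₀ = moment k k Pₖ
    M₁ = moment (suc k) (suc k) Pₖ₊₁
    ℓPₖ = linP (a (suc k)) (lam (suc k)) Pₖ

    Pₖ₊₂⊥xᵏ : moment (suc k) k Pₖ₊₂ ≡ 0#
    Pₖ₊₂⊥xᵏ = begin
      moment (suc k) k Pₖ₊₂
        ≡⟨ moment-compatible (suc k) k Pₖ₊₂ ⟩
      a (suc (suc k)) * moment (suc (suc k)) (suc k) Pₖ₊₂ + lam (suc (suc k)) * moment (suc (suc k)) k Pₖ₊₂
        ≡⟨ cong₂ (λ u v → a (suc (suc k)) * u + lam (suc (suc k)) * v)
             (moment-orthogonal (suc (suc k)) (suc k) ℕP.≤-refl) (moment-orthogonal (suc (suc k)) k (ℕP.n≤1+n _)) ⟩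
      a (suc (suc k)) * 0# + lam (suc (suc k)) * 0#
        ≡⟨ solve 2 (λ α β → α :* :0 :+ β :* :0 := :0) refl (a (suc (suc k))) (lam (suc (suc k))) ⟩
      0# ∎

    M₁-M₀≡0 : M₁ + - M₀ ≡ 0#
    M₁-M₀≡0 = begin
      M₁ + - M₀
        ≡⟨ solve 3 (λ A β B → A :+ :- B := A :+ :- β :* :0 :+ :- :1 :* B) refl M₁ (b (suc k)) M₀ ⟩
      M₁ + - b (suc k) * 0# + - 1# * M₀
        ≡⟨ cong₂ (λ u v → M₁ + - b (suc k) * u + - 1# * v) (sym (moment-orthogonal (suc k) k ℕP.≤-refl))
             (trans (moment-compatible k k Pₖ) (sym (moment-linP (suc k) k (a (suc k)) (lam (suc k)) Pₖ))) ⟩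
      M₁ + - b (suc k) * moment (suc k) k Pₖ₊₁ + - 1# * moment (suc k) k ℓPₖ
        ≡⟨ sym (moment-recurrence (suc k) k (suc k)) ⟩
      moment (suc k) k Pₖ₊₂
        ≡⟨ Pₖ₊₂⊥xᵏ ⟩
      0# ∎

    step : M₁ ≡ M₀
    step = begin
      M₁               ≡⟨ solve 2 (λ A B → A := (A :+ :- B) :+ B) refl M₁ M₀ ⟩
      (M₁ + - M₀) + M₀ ≡⟨ cong (_+ M₀) M₁-M₀≡0 ⟩
      0# + M₀          ≡⟨ solve 1 (λ B → :0 :+ B := B) refl M₀ ⟩
      M₀               ∎

module Denominators {c : Level} (F : Field c) (a lam : ℕ → Field.Carrier F) where
  open Field F
  open Setup F
  open FieldSolver F
  open FieldLemmas F
  open ≡-Reasoning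

  -- d_m(x) / d_j(x) for j ≤ m; the value for j > m is irrelevant.
  dRatio : ℕ → ℕ → Carrier → Carrier
  dRatio j zero    x = 1#
  dRatio j (suc m) x with j ℕ.≤? m
  ... | yes _ = dRatio j m x * (a (suc m) * x + lam (suc m))
  ... | no _  = 1#

  dRatio-suc : ∀ j m x → j ℕ.≤ m → dRatio j (suc m) x ≡ dRatio j m x * (a (suc m) * x + lam (suc m))
  dRatio-suc j m x j≤m with j ℕ.≤? m
  ... | yes _   = refl
  ... | no j≰m = ⊥-elim (j≰m j≤m)

  dRatio-self : ∀ m x → dRatio m m x ≡ 1#
  dRatio-self zero    x = refl
  dRatio-self (suc m) x with suc m ℕ.≤? m
  ... | yes m+1≤m = ⊥-elim (ℕP.<-irrefl refl m+1≤m)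
  ... | no _      = refl

  d-factor : ∀ j m x → j ℕ.≤ m → d a lam m x ≡ d a lam j x * dRatio j m x
  d-factor j m x j≤m with ℕP.m≤n⇒m<n∨m≡n j≤m
  ... | inj₂ refl = begin
    d a lam m x                 ≡⟨ solve 1 (λ u → u := u :* :1) refl (d a lam m x) ⟩
    d a lam m x * 1#            ≡⟨ cong (d a lam m x *_) (sym (dRatio-self m x)) ⟩
    d a lam m x * dRatio m m x  ∎
  d-factor j (suc m) x _ | inj₁ (s≤s j≤m) = begin
    d a lam m x * ℓ                     ≡⟨ cong (_* ℓ) (d-factor j m x j≤m) ⟩
    d a lam j x * dRatio j m x * ℓ      ≡⟨ solve 3 (λ u v w → u :* v :* w := u :* (v :* w)) refl (d a lam j x) (dRatio j m x) ℓ ⟩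
    d a lam j x * (dRatio j m x * ℓ)    ≡⟨ cong (d a lam j x *_) (sym (dRatio-suc j m x j≤m)) ⟩
    d a lam j x * dRatio j (suc m) x    ∎
    where ℓ = a (suc m) * x + lam (suc m)

  dRatio-*-inv : ∀ j m x → j ℕ.≤ m → (dₘ≢0 : d a lam m x ≢ 0#) (dⱼ≢0 : d a lam j x ≢ 0#) →
                 dRatio j m x * inv (d a lam m x) dₘ≢0 ≡ inv (d a lam j x) dⱼ≢0
  dRatio-*-inv j m x j≤m dₘ≢0 dⱼ≢0 = sym (inv-unique _ dⱼ≢0 _ (begin
    dRatio j m x * inv (d a lam m x) dₘ≢0 * d a lam j x
      ≡⟨ solve 3 (λ u v w → u :* v :* w := v :* (w :* u)) refl (dRatio j m x) (inv (d a lam m x) dₘ≢0) (d a lam j x) ⟩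
    inv (d a lam m x) dₘ≢0 * (d a lam j x * dRatio j m x) ≡⟨ cong (inv (d a lam m x) dₘ≢0 *_) (sym (d-factor j m x j≤m)) ⟩
    inv (d a lam m x) dₘ≢0 * d a lam m x                 ≡⟨ inv-inverse _ dₘ≢0 ⟩
    1#                                                    ∎))

module PartialFractions {c : Level} (F : Field c) (a lam : ℕ → Field.Carrier F)
  (ha : (n : ℕ) → 1 ℕ.≤ n → a n ≢ Field.0# F)
  (L : ℕ → Setup.Poly F → Field.Carrier F) (linear : Setup.IsLinearOnV F a lam L) where
  open Field F
  open Setup F
  open FieldSolver F
  open PolynomialLemmas F
  open Moments F a lam L linear
  open ≡-Reasoning

  a⁻¹ : ℕ → Carrier
  a⁻¹ m = inv (a (suc m)) (ha (suc m) (s≤s z≤n))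

  root : ℕ → Carrier
  root m = - lam (suc m) * a⁻¹ m

  a⁻¹-factor : ∀ m x → a⁻¹ m * (a (suc m) * x + lam (suc m)) ≡ x + - root m
  a⁻¹-factor m x = begin
    a⁻¹ m * (a (suc m) * x + lam (suc m))
      ≡⟨ solve 4 (λ i α x β → i :* (α :* x :+ β) := (i :* α) :* x :+ :- (:- β :* i)) refl (a⁻¹ m) (a (suc m)) x (lam (suc m)) ⟩
    (a⁻¹ m * a (suc m)) * x + - root m      ≡⟨ cong (λ z → z * x + - root m) (inv-inverse _ _) ⟩
    1# * x + - root m                       ≡⟨ solve 2 (λ x r → :1 :* x :+ r := x :+ r) refl x (- root m) ⟩
    x + - root m                            ∎

  -- p / d_{m+1} = a_{m+1}⁻¹ q / d_m + p(ρ) / d_{m+1}  where  p = (x - ρ) q + p(ρ)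
  moment-divByLinear : ∀ m s p →
    moment (suc m) s p ≡ a⁻¹ m * moment m s (divByLinear (root m) p) + evalP p (root m) * ν L s (suc m)
  moment-divByLinear m s []          = solve 2 (λ i n → :0 := i :* :0 :+ :0 :* n) refl (a⁻¹ m) (ν L s (suc m))
  moment-divByLinear m s (u ∷ [])    =
    solve 4 (λ u n i r → u :* n :+ :0 := i :* :0 :+ (u :+ r :* :0) :* n) refl u (ν L s (suc m)) (a⁻¹ m) (root m)
  moment-divByLinear m s (u ∷ v ∷ p) = sym (begin
    i * (r′ * ν L s m + q) + (u + root m * r′) * N₀
      ≡⟨ cong (λ z → i * (r′ * z + q) + (u + root m * r′) * N₀) (ν-compatible s m) ⟩
    i * (r′ * (α * N₁ + β * N₀) + q) + (u + (- β * i) * r′) * N₀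
      ≡⟨ solve 8 (λ i r′ α N₁ β N₀ q u → i :* (r′ :* (α :* N₁ :+ β :* N₀) :+ q) :+ (u :+ (:- β :* i) :* r′) :* N₀
                   := (i :* α) :* (r′ :* N₁) :+ i :* q :+ u :* N₀) refl i r′ α N₁ β N₀ q u ⟩
    (i * α) * (r′ * N₁) + i * q + u * N₀             ≡⟨ cong (λ z → z * (r′ * N₁) + i * q + u * N₀) (inv-inverse _ _) ⟩
    1# * (r′ * N₁) + i * q + u * N₀
      ≡⟨ solve 5 (λ r′ N₁ i q uN → :1 :* (r′ :* N₁) :+ i :* q :+ uN := uN :+ (i :* q :+ r′ :* N₁)) refl r′ N₁ i q (u * N₀) ⟩
    u * N₀ + (i * q + r′ * N₁)                       ≡⟨ cong (u * N₀ +_) (sym (moment-divByLinear m (suc s) (v ∷ p))) ⟩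
    u * N₀ + moment (suc m) (suc s) (v ∷ p)          ∎)
    where
    i = a⁻¹ m
    α = a (suc m)
    β = lam (suc m)
    r′ = evalP (v ∷ p) (root m)
    q = moment m (suc s) (divByLinear (root m) (v ∷ p))
    N₀ = ν L s (suc m)
    N₁ = ν L (suc s) (suc m)

  module Basis (β : ℕ → Poly) (β-zero : β 0 ≡ 1# ∷ []) (length-β : ∀ m → length (β m) ℕ.≤ suc m)
               (β-root≢0 : ∀ m → evalP (β (suc m)) (root m) ≢ 0#) where
    open FiniteSums F
    open Denominators F a lam

    -- p / d_m = Σ_{j ≤ m} coeff j · β_j / d_j, recorded through its image under x^s ↦ 𝓛 and
    -- pointwise after multiplying by d_m.
    record Expansion (m : ℕ) (p : Poly) : Set c where
      field
        coeff            : ℕ → Carrier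
        coeff-vanishes   : ∀ j → m ℕ.< j → coeff j ≡ 0#
        moment-expansion : ∀ N → m ℕ.< N → ∀ s →
          moment m s p ≡ sumFin N (λ j → coeff (toℕ j) * moment (toℕ j) s (β (toℕ j)))
        evalP-expansion  : ∀ N → m ℕ.< N → ∀ x →
          evalP p x ≡ sumFin N (λ j → coeff (toℕ j) * (evalP (β (toℕ j)) x * dRatio (toℕ j) m x))

    κ : ℕ → Poly → Carrier
    κ m p = evalP p (root m) * inv (evalP (β (suc m)) (root m)) (β-root≢0 m)

    κ-β : ∀ m p → κ m p * evalP (β (suc m)) (root m) ≡ evalP p (root m)
    κ-β m p = begin
      evalP p (root m) * inv βρ (β-root≢0 m) * βρ
        ≡⟨ solve 3 (λ u v w → u :* v :* w := u :* (v :* w)) refl (evalP p (root m)) (inv βρ (β-root≢0 m)) βρ ⟩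
      evalP p (root m) * (inv βρ (β-root≢0 m) * βρ) ≡⟨ cong (evalP p (root m) *_) (inv-inverse _ _) ⟩
      evalP p (root m) * 1#                          ≡⟨ solve 1 (λ u → u :* :1 := u) refl (evalP p (root m)) ⟩
      evalP p (root m)                               ∎
      where
      βρ = evalP (β (suc m)) (root m)

    -- p - κ β_{m+1} vanishes at the root, so it is (x - root) times this polynomial of length ≤ m + 1
    reduce : ℕ → Poly → Poly
    reduce m p = addP (divByLinear (root m) p) (scaleP (- κ m p) (divByLinear (root m) (β (suc m))))

    length-reduce : ∀ m p → length p ℕ.≤ suc (suc m) → length (reduce m p) ℕ.≤ suc m
    length-reduce m p p≤m+2 = length-addP (suc m) (divByLinear (root m) p) (scaleP (- κ m p) qβ)
      (subst (ℕ._≤ suc m) (sym (length-divByLinear (root m) p)) (ℕP.pred-mono-≤ p≤m+2))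
      (subst (ℕ._≤ suc m) (sym (trans (length-scaleP (- κ m p) qβ) (length-divByLinear (root m) (β (suc m)))))
        (ℕP.pred-mono-≤ (length-β (suc m))))
      where qβ = divByLinear (root m) (β (suc m))

    -- Both say  p / d_{m+1} = κ β_{m+1} / d_{m+1} + a⁻¹ reduce(p) / d_m.
    evalP-reduce : ∀ m p x → evalP p x ≡ κ m p * evalP (β (suc m)) x + (x + - root m) * evalP (reduce m p) x
    evalP-reduce m p x = begin
      evalP p x                                    ≡⟨ evalP-divByLinear ρ p x ⟩
      w * evalP q x + evalP p ρ                    ≡⟨ cong (w * evalP q x +_) (sym (κ-β m p)) ⟩
      w * evalP q x + k * evalP β′ ρ
        ≡⟨ solve 5 (λ w Q k B′ Qβ → w :* Q :+ k :* B′ := k :* (w :* Qβ :+ B′) :+ w :* (Q :+ :- k :* Qβ)) refl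
             w (evalP q x) k (evalP β′ ρ) (evalP qβ x) ⟩
      k * (w * evalP qβ x + evalP β′ ρ) + w * (evalP q x + - k * evalP qβ x)
        ≡⟨ cong₂ (λ u v → k * u + w * v) (sym (evalP-divByLinear ρ β′ x))
             (sym (trans (evalP-addP q (scaleP (- k) qβ) x) (cong (evalP q x +_) (evalP-scaleP (- k) qβ x)))) ⟩
      k * evalP β′ x + w * evalP (reduce m p) x    ∎
      where
      ρ = root m
      w = x + - ρ
      k = κ m p
      β′ = β (suc m)
      q = divByLinear ρ p
      qβ = divByLinear ρ β′

    moment-reduce : ∀ m s p → moment (suc m) s p ≡ κ m p * moment (suc m) s (β (suc m)) + a⁻¹ m * moment m s (reduce m p)
    moment-reduce m s p = begin
      moment (suc m) s p                           ≡⟨ moment-divByLinear m s p ⟩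
      i * moment m s q + evalP p ρ * N₀            ≡⟨ cong (λ z → i * moment m s q + z * N₀) (sym (κ-β m p)) ⟩
      i * moment m s q + (k * evalP β′ ρ) * N₀
        ≡⟨ solve 6 (λ i Q k B′ n Qβ → i :* Q :+ (k :* B′) :* n := k :* (i :* Qβ :+ B′ :* n) :+ i :* (Q :+ :- k :* Qβ)) refl
             i (moment m s q) k (evalP β′ ρ) N₀ (moment m s qβ) ⟩
      k * (i * moment m s qβ + evalP β′ ρ * N₀) + i * (moment m s q + - k * moment m s qβ)
        ≡⟨ cong₂ (λ u v → k * u + i * v) (sym (moment-divByLinear m s β′))
             (sym (trans (moment-addP m s q (scaleP (- k) qβ)) (cong (moment m s q +_) (moment-scaleP m s (- k) qβ)))) ⟩
      k * moment (suc m) s β′ + i * moment m s (reduce m p) ∎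
      where
      i = a⁻¹ m
      ρ = root m
      k = κ m p
      β′ = β (suc m)
      q = divByLinear ρ p
      qβ = divByLinear ρ β′
      N₀ = ν L s (suc m)

    expansion-suc : ∀ m p → Expansion m (reduce m p) → Expansion (suc m) p
    expansion-suc m p E = record
      { coeff = coeff ; coeff-vanishes = coeff-vanishes ; moment-expansion = moment-expansion ; evalP-expansion = evalP-expansion }
      where
      module E = Expansion E
      i = a⁻¹ m
      k = κ m p

      coeff : ℕ → Carrier
      coeff j = pointMass (suc m) k j + i * E.coeff j

      coeff-vanishes : ∀ j → suc m ℕ.< j → coeff j ≡ 0#
      coeff-vanishes j m+1<j = begin
        pointMass (suc m) k j + i * E.coeff j
          ≡⟨ cong₂ (λ u v → u + i * v) (pointMass-off (suc m) k j (λ j≡m+1 → ℕP.<-irrefl (sym j≡m+1) m+1<j))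
                                        (E.coeff-vanishes j (ℕP.<-trans (ℕP.n<1+n m) m+1<j)) ⟩
        0# + i * 0#                           ≡⟨ solve 1 (λ i → :0 :+ i :* :0 := :0) refl i ⟩
        0#                                    ∎

      moment-expansion : ∀ N → suc m ℕ.< N → ∀ s →
        moment (suc m) s p ≡ sumFin N (λ j → coeff (toℕ j) * moment (toℕ j) s (β (toℕ j)))
      moment-expansion N m+1<N s = begin
        moment (suc m) s p
          ≡⟨ moment-reduce m s p ⟩
        k * moment (suc m) s (β (suc m)) + i * moment m s (reduce m p)
          ≡⟨ cong (λ z → k * moment (suc m) s (β (suc m)) + i * z) (E.moment-expansion N (ℕP.<-trans (ℕP.n<1+n m) m+1<N) s) ⟩
        k * moment (suc m) s (β (suc m)) + i * sumFin N (λ j → E.coeff (toℕ j) * moment (toℕ j) s (β (toℕ j)))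
          ≡⟨ sym (sumFin-pointMass-+ N (suc m) k i E.coeff (λ j → moment j s (β j)) m+1<N) ⟩
        sumFin N (λ j → coeff (toℕ j) * moment (toℕ j) s (β (toℕ j))) ∎

      evalP-expansion : ∀ N → suc m ℕ.< N → ∀ x →
        evalP p x ≡ sumFin N (λ j → coeff (toℕ j) * (evalP (β (toℕ j)) x * dRatio (toℕ j) (suc m) x))
      evalP-expansion N m+1<N x = begin
        evalP p x
          ≡⟨ evalP-reduce m p x ⟩
        k * evalP (β (suc m)) x + (x + - root m) * evalP (reduce m p) x
          ≡⟨ cong₂ (λ u v → k * u + v) (sym (trans (cong (evalP (β (suc m)) x *_) (dRatio-self (suc m) x))
                                                   (solve 1 (λ y → y :* :1 := y) refl (evalP (β (suc m)) x))))
                                        reduce-expansion ⟩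
        k * (evalP (β (suc m)) x * dRatio (suc m) (suc m) x) + i * sumFin N (λ j → E.coeff (toℕ j) * βd (toℕ j) (suc m))
          ≡⟨ sym (sumFin-pointMass-+ N (suc m) k i E.coeff (λ j → βd j (suc m)) m+1<N) ⟩
        sumFin N (λ j → coeff (toℕ j) * (evalP (β (toℕ j)) x * dRatio (toℕ j) (suc m) x)) ∎
        where
        ℓ = a (suc m) * x + lam (suc m)
        βd : ℕ → ℕ → Carrier
        βd j m′ = evalP (β j) x * dRatio j m′ x
        factor-ℓ : ∀ j → E.coeff j * βd j (suc m) ≡ ℓ * (E.coeff j * βd j m)
        factor-ℓ j with ℕP.≤-<-connex j m
        ... | inj₁ j≤m rewrite dRatio-suc j m x j≤m =
          solve 4 (λ t e r l → t :* (e :* (r :* l)) := l :* (t :* (e :* r))) refl (E.coeff j) (evalP (β j) x) (dRatio j m x) ℓ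
        ... | inj₂ m<j rewrite E.coeff-vanishes j m<j =
          solve 3 (λ u v l → :0 :* u := l :* (:0 :* v)) refl (βd j (suc m)) (βd j m) ℓ
        reduce-expansion : (x + - root m) * evalP (reduce m p) x ≡ i * sumFin N (λ j → E.coeff (toℕ j) * βd (toℕ j) (suc m))
        reduce-expansion = begin
          (x + - root m) * evalP (reduce m p) x                        ≡⟨ cong (_* evalP (reduce m p) x) (sym (a⁻¹-factor m x)) ⟩
          (i * ℓ) * evalP (reduce m p) x
            ≡⟨ cong ((i * ℓ) *_) (E.evalP-expansion N (ℕP.<-trans (ℕP.n<1+n m) m+1<N) x) ⟩
          (i * ℓ) * sumFin N (λ j → E.coeff (toℕ j) * βd (toℕ j) m)
            ≡⟨ solve 3 (λ i l S → (i :* l) :* S := i :* (l :* S)) refl i ℓ (sumFin N (λ j → E.coeff (toℕ j) * βd (toℕ j) m)) ⟩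
          i * (ℓ * sumFin N (λ j → E.coeff (toℕ j) * βd (toℕ j) m))
            ≡⟨ cong (i *_) (sym (trans (sumFin-cong N (factor-ℓ ∘ toℕ)) (sumFin-*ˡ N (λ j → E.coeff (toℕ j) * βd (toℕ j) m) ℓ))) ⟩
          i * sumFin N (λ j → E.coeff (toℕ j) * βd (toℕ j) (suc m))    ∎

    expansion : ∀ m p → length p ℕ.≤ suc m → Expansion m p
    expansion zero    []          _ = record
      { coeff = λ _ → 0#
      ; coeff-vanishes = λ _ _ → refl
      ; moment-expansion = λ N _ s → sym (sumFin-0* N (λ j → moment (toℕ j) s (β (toℕ j))))
      ; evalP-expansion  = λ N _ x → sym (sumFin-0* N (λ j → evalP (β (toℕ j)) x * dRatio (toℕ j) 0 x))
      }
    expansion zero    (u ∷ [])    _ = record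
      { coeff = pointMass 0 u
      ; coeff-vanishes = λ j 0<j → pointMass-off 0 u j (λ j≡0 → ℕP.<-irrefl (sym j≡0) 0<j)
      ; moment-expansion = λ N 0<N s → sym (begin
          sumFin N (λ j → pointMass 0 u (toℕ j) * moment (toℕ j) s (β (toℕ j)))
                                      ≡⟨ sumFin-pointMass N 0 u (λ j → moment j s (β j)) 0<N ⟩
          u * moment 0 s (β 0)        ≡⟨ cong (λ z → u * moment 0 s z) β-zero ⟩
          u * (1# * ν L s 0 + 0#)     ≡⟨ solve 2 (λ u n → u :* (:1 :* n :+ :0) := u :* n :+ :0) refl u (ν L s 0) ⟩
          u * ν L s 0 + 0#            ∎)
      ; evalP-expansion = λ N 0<N x → sym (begin
          sumFin N (λ j → pointMass 0 u (toℕ j) * (evalP (β (toℕ j)) x * dRatio (toℕ j) 0 x))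
                                      ≡⟨ sumFin-pointMass N 0 u (λ j → evalP (β j) x * dRatio j 0 x) 0<N ⟩
          u * (evalP (β 0) x * 1#)    ≡⟨ cong (λ z → u * (evalP z x * 1#)) β-zero ⟩
          u * ((1# + x * 0#) * 1#)    ≡⟨ solve 2 (λ u x → u :* ((:1 :+ x :* :0) :* :1) := u :+ x :* :0) refl u x ⟩
          u + x * 0#                  ∎)
      }
    expansion zero    (u ∷ v ∷ p) (s≤s ())
    expansion (suc m) p           p≤m+2 = expansion-suc m p (expansion m (reduce m p) (length-reduce m p p≤m+2))

module BorderedRows {c : Level} (F : Field c) where
  open Field F
  open Setup F

  bordered-last : ∀ n row last (i j : Fin (suc n)) → toℕ i ≡ n → bordered n row last i j ≡ last j
  bordered-last n row last i j i≡n with toℕ i ≡ᵇ n in eq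
  ... | true  = refl
  ... | false = ⊥-elim (subst T eq (ℕP.≡⇒≡ᵇ _ _ i≡n))

  bordered-row : ∀ n row last (i j : Fin (suc n)) → toℕ i ℕ.< n → bordered n row last i j ≡ row (toℕ i) (toℕ j)
  bordered-row n row last i j i<n with toℕ i ≡ᵇ n in eq
  ... | true  = ⊥-elim (ℕP.<-irrefl (ℕP.≡ᵇ⇒≡ _ _ (subst T (sym eq) _)) i<n)
  ... | false = refl

  bordered-self : ∀ n row (i j : Fin (suc n)) → bordered n row (λ j → row n (toℕ j)) i j ≡ row (toℕ i) (toℕ j)
  bordered-self n row i j with toℕ i ≡ᵇ n in eq
  ... | true  = cong (λ m → row m (toℕ j)) (sym (ℕP.≡ᵇ⇒≡ _ _ (subst T (sym eq) _)))
  ... | false = refl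

module DeterminantFormula {c : Level} (F : Field c) (b a lam : ℕ → Field.Carrier F)
  (ha : (n : ℕ) → 1 ℕ.≤ n → a n ≢ Field.0# F)
  (L : ℕ → Setup.Poly F → Field.Carrier F) (isMoment : Setup.IsMomentFunctional F b a lam L)
  (β : ℕ → Setup.Poly F) (β-zero : β 0 ≡ Field.1# F ∷ []) (length-β : ∀ m → length (β m) ℕ.≤ suc m) where
  open Field F
  open Setup F
  open FieldSolver F
  open FieldLemmas F
  open FiniteSums F
  open Determinants F
  open BorderedRows F
  open Denominators F a lam
  open OrthogonalPolynomials F b a lam L isMoment
  open IsMomentFunctional isMoment using (linear)
  open Moments F a lam L linear
  open PartialFractions F a lam ha L linear
  open ≡-Reasoning

  module Bordered (β-root≢0 : ∀ m → evalP (β (suc m)) (root m) ≢ 0#) where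
    open Basis β β-zero length-β β-root≢0

    -- transition j k: the coefficient of β_j / d_j in Q_k
    transition : ℕ → ℕ → Carrier
    transition j k = Expansion.coeff (expansion k (P b a lam k) (length-P k)) j

    transition-upper : ∀ j k → k ℕ.< j → transition j k ≡ 0#
    transition-upper j k = Expansion.coeff-vanishes (expansion k (P b a lam k) (length-P k)) j

    gram : ℕ → ℕ → Carrier
    gram i k = moment k i (P b a lam k)

    det-bordered-gram : ∀ n (w : Fin (suc n) → Carrier) → det (suc n) (bordered n gram w) ≡ w (fromℕ n)
    det-bordered-gram n w = trans (det-lowerTriangular n (bordered n gram w) upper≡0 diagonal≡1)
                                  (bordered-last n gram w (fromℕ n) (fromℕ n) (FP.toℕ-fromℕ n))
      where
      upper≡0 : ∀ i j → toℕ i ℕ.< toℕ j → bordered n gram w i j ≡ 0#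
      upper≡0 i j i<j = trans (bordered-row n gram w i j (ℕP.<-≤-trans i<j (FP.toℕ≤pred[n] j)))
                              (moment-orthogonal (toℕ j) (toℕ i) i<j)
      diagonal≡1 : ∀ i → toℕ i ℕ.< n → bordered n gram w i i ≡ 1#
      diagonal≡1 i i<n = trans (bordered-row n gram w i i i<n) (moment-diagonal (toℕ i))

    module Row (n : ℕ) (row : ℕ → ℕ → Carrier) (row≡moment : ∀ i j → moment j i (β j) ≡ row i j) where

      gram-expansion : ∀ i (k : Fin (suc n)) → gram i (toℕ k) ≡ sumFin (suc n) (λ j → transition (toℕ j) (toℕ k) * row i (toℕ j))
      gram-expansion i k = begin
        moment (toℕ k) i (P b a lam (toℕ k))
          ≡⟨ Expansion.moment-expansion (expansion (toℕ k) (P b a lam (toℕ k)) (length-P (toℕ k))) (suc n) (FP.toℕ<n k) i ⟩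
        sumFin (suc n) (λ j → transition (toℕ j) (toℕ k) * moment (toℕ j) i (β (toℕ j)))
          ≡⟨ sumFin-cong (suc n) (λ j → cong (transition (toℕ j) (toℕ k) *_) (row≡moment i (toℕ j))) ⟩
        sumFin (suc n) (λ j → transition (toℕ j) (toℕ k) * row i (toℕ j)) ∎

      det-bordered-combination : ∀ (v w : Fin (suc n) → Carrier) →
        (∀ k → w k ≡ sumFin (suc n) (λ j → transition (toℕ j) (toℕ k) * v j)) →
        det (suc n) (bordered n gram w) ≡ diagonalProduct transition 0 (suc n) * det (suc n) (bordered n row v)
      det-bordered-combination v w w≡Σ =
        det-upperTriangularCombination (suc n) (bordered n row v) (bordered n gram w) transition transition-upper combination
        where
        combination : ∀ i k → bordered n gram w i k ≡ sumFin (suc n) (λ j → transition (toℕ j) (toℕ k) * bordered n row v i j)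
        combination i k with ℕP.m≤n⇒m<n∨m≡n (FP.toℕ≤pred[n] i)
        ... | inj₂ i≡n = begin
          bordered n gram w i k                                     ≡⟨ bordered-last n gram w i k i≡n ⟩
          w k                                                       ≡⟨ w≡Σ k ⟩
          sumFin (suc n) (λ j → transition (toℕ j) (toℕ k) * v j)
            ≡⟨ sumFin-cong (suc n) (λ j → cong (transition (toℕ j) (toℕ k) *_) (sym (bordered-last n row v i j i≡n))) ⟩
          sumFin (suc n) (λ j → transition (toℕ j) (toℕ k) * bordered n row v i j) ∎
        ... | inj₁ i<n = begin
          bordered n gram w i k                                     ≡⟨ bordered-row n gram w i k i<n ⟩
          gram (toℕ i) (toℕ k)                                      ≡⟨ gram-expansion (toℕ i) k ⟩
          sumFin (suc n) (λ j → transition (toℕ j) (toℕ k) * row (toℕ i) (toℕ j))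
            ≡⟨ sumFin-cong (suc n) (λ j → cong (transition (toℕ j) (toℕ k) *_) (sym (bordered-row n row v i j i<n))) ⟩
          sumFin (suc n) (λ j → transition (toℕ j) (toℕ k) * bordered n row v i j) ∎

      Δ : Carrier
      Δ = det (suc n) (λ i j → row (toℕ i) (toℕ j))

      D : Carrier
      D = diagonalProduct transition 0 (suc n)

      D*Δ≡1 : D * Δ ≡ 1#
      D*Δ≡1 = begin
        D * Δ                                                      ≡⟨ cong (D *_) (sym (det-cong (suc n) (bordered-self n row))) ⟩
        D * det (suc n) (bordered n row (λ j → row n (toℕ j)))
          ≡⟨ sym (det-bordered-combination (λ j → row n (toℕ j)) (λ k → gram n (toℕ k)) (gram-expansion n)) ⟩
        det (suc n) (bordered n gram (λ k → gram n (toℕ k)))       ≡⟨ det-bordered-gram n (λ k → gram n (toℕ k)) ⟩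
        gram n (toℕ (fromℕ n))                                     ≡⟨ cong (gram n) (FP.toℕ-fromℕ n) ⟩
        gram n n                                                   ≡⟨ moment-diagonal n ⟩
        1#                                                         ∎

      Δ≢0 : Δ ≢ 0#
      Δ≢0 = *≡1⇒≢0ʳ D Δ D*Δ≡1

      Q-bordered : ∀ x (hx : (j : ℕ) → j ℕ.≤ n → d a lam j x ≢ 0#) (last : Fin (suc n) → Carrier) →
        (∀ j → last j ≡ evalP (β (toℕ j)) x * inv (d a lam (toℕ j) x) (hx (toℕ j) (FP.toℕ≤pred[n] j))) →
        Q b a lam n x hx ≡ inv Δ Δ≢0 * det (suc n) (bordered n row last)
      Q-bordered x hx last last≡ = begin
        Q b a lam n x hx                              ≡⟨ sym (Qₖ-at (toℕ (fromℕ n)) (FP.toℕ-fromℕ n) _) ⟩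
        Qₖ (fromℕ n)                                  ≡⟨ sym (det-bordered-gram n Qₖ) ⟩
        det (suc n) (bordered n gram Qₖ)              ≡⟨ det-bordered-combination last Qₖ Qₖ-expansion ⟩
        D * det (suc n) (bordered n row last)
          ≡⟨ cong (_* det (suc n) (bordered n row last)) (sym (inv-unique Δ Δ≢0 D D*Δ≡1)) ⟩
        inv Δ Δ≢0 * det (suc n) (bordered n row last) ∎
        where
        d⁻¹ : (k : Fin (suc n)) → Carrier
        d⁻¹ k = inv (d a lam (toℕ k) x) (hx (toℕ k) (FP.toℕ≤pred[n] k))

        Qₖ : Fin (suc n) → Carrier
        Qₖ k = evalP (P b a lam (toℕ k)) x * d⁻¹ k

        Qₖ-at : ∀ m → m ≡ n → (dₘ≢0 : d a lam m x ≢ 0#) → evalP (P b a lam m) x * inv (d a lam m x) dₘ≢0 ≡ Q b a lam n x hx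
        Qₖ-at m refl dₘ≢0 = cong (evalP (P b a lam m) x *_) (inv-irrelevant _ dₘ≢0 (hx m ℕP.≤-refl))

        Qₖ-expansion : ∀ k → Qₖ k ≡ sumFin (suc n) (λ j → transition (toℕ j) (toℕ k) * last j)
        Qₖ-expansion k = sym (begin
          sumFin (suc n) (λ j → t j * last j)                ≡⟨ sumFin-cong (suc n) term ⟩
          sumFin (suc n) (λ j → d⁻¹ k * (t j * (βₓ j * r j))) ≡⟨ sumFin-*ˡ (suc n) (λ j → t j * (βₓ j * r j)) (d⁻¹ k) ⟩
          d⁻¹ k * sumFin (suc n) (λ j → t j * (βₓ j * r j))
            ≡⟨ cong (d⁻¹ k *_) (sym (Expansion.evalP-expansion E (suc n) (FP.toℕ<n k) x)) ⟩
          d⁻¹ k * evalP (P b a lam K) x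
            ≡⟨ solve 2 (λ u v → u :* v := v :* u) refl (d⁻¹ k) (evalP (P b a lam K) x) ⟩
          Qₖ k                                                ∎)
          where
          K = toℕ k
          E = expansion K (P b a lam K) (length-P K)
          t βₓ r : Fin (suc n) → Carrier
          t j = transition (toℕ j) K
          βₓ j = evalP (β (toℕ j)) x
          r j = dRatio (toℕ j) K x
          term : ∀ j → t j * last j ≡ d⁻¹ k * (t j * (βₓ j * r j))
          term j with ℕP.≤-<-connex (toℕ j) K
          ... | inj₁ j≤K = begin
            t j * last j                 ≡⟨ cong (t j *_) (last≡ j) ⟩
            t j * (βₓ j * d⁻¹ j)         ≡⟨ cong (λ z → t j * (βₓ j * z)) (sym (dRatio-*-inv (toℕ j) K x j≤K _ _)) ⟩
            t j * (βₓ j * (r j * d⁻¹ k))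
              ≡⟨ solve 4 (λ t e r i → t :* (e :* (r :* i)) := i :* (t :* (e :* r))) refl (t j) (βₓ j) (r j) (d⁻¹ k) ⟩
            d⁻¹ k * (t j * (βₓ j * r j)) ∎
          ... | inj₂ K<j rewrite transition-upper (toℕ j) K K<j =
            solve 3 (λ u i v → :0 :* u := i :* (:0 :* v)) refl (last j) (d⁻¹ k) (βₓ j * r j)

module BorderedFormulas {c : Level} (F : Field c) (b a lam : ℕ → Field.Carrier F)
  (ha : (n : ℕ) → 1 ℕ.≤ n → a n ≢ Field.0# F)
  (L : ℕ → Setup.Poly F → Field.Carrier F) (isMoment : Setup.IsMomentFunctional F b a lam L) where
  open Field F
  open Setup F
  open FieldSolver F
  open FieldLemmas F
  open PolynomialLemmas F
  open IsMomentFunctional isMoment using (linear)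
  open Moments F a lam L linear
  open PartialFractions F a lam ha L linear using (root)

  Q-bordered-monomials : ((k : ℕ) → lam k ≢ 0#) → (n : ℕ) → Σ (Δ'' L n ≢ 0#) (λ nz →
    (x : Carrier) (hx : (j : ℕ) → j ℕ.≤ n → d a lam j x ≢ 0#) →
    Q b a lam n x hx ≡ inv (Δ'' L n) nz * det (suc n) (bordered n (λ i j → ν L (i ℕ.+ j) j) (lastRow'' a lam n x hx)))
  Q-bordered-monomials lam≢0 n = Δ≢0 , λ x hx → Q-bordered x hx (lastRow'' a lam n x hx)
      (λ j → cong (_* inv (d a lam (toℕ j) x) (hx (toℕ j) (FP.toℕ≤pred[n] j))) (sym (evalP-monomial (toℕ j) x)))
    where
    root≢0 : ∀ m → root m ≢ 0#
    root≢0 m = *-nonzero _ _ (-‿nonzero _ (lam≢0 (suc m))) (inv-nonzero _ _)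
    monomial-root≢0 : ∀ m → evalP (monomial (suc m)) (root m) ≢ 0#
    monomial-root≢0 m eq = ^-nonzero (root m) (suc m) (root≢0 m) (trans (sym (evalP-monomial (suc m) (root m))) eq)
    open DeterminantFormula F b a lam ha L isMoment monomial refl (ℕP.≤-reflexive ∘ length-monomial)
    open Bordered.Row monomial-root≢0 n (λ i j → ν L (i ℕ.+ j) j) (λ i j → moment-monomial j i j)

  Q-bordered-constants : (n : ℕ) → Σ (Δ''' L n ≢ 0#) (λ nz →
    (x : Carrier) (hx : (j : ℕ) → j ℕ.≤ n → d a lam j x ≢ 0#) →
    Q b a lam n x hx ≡ inv (Δ''' L n) nz * det (suc n) (bordered n (λ i j → ν L i j) (lastRow''' a lam n x hx)))
  Q-bordered-constants n = Δ≢0 , λ x hx → Q-bordered x hx (lastRow''' a lam n x hx)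
      (λ j → solve 2 (λ x v → v := (:1 :+ x :* :0) :* v) refl x (inv (d a lam (toℕ j) x) (hx (toℕ j) (FP.toℕ≤pred[n] j))))
    where
    one-root≢0 : ∀ m → evalP (1# ∷ []) (root m) ≢ 0#
    one-root≢0 m eq = 1≢0 (trans (solve 1 (λ r → :1 := :1 :+ r :* :0) refl (root m)) eq)
    open DeterminantFormula F b a lam ha L isMoment (λ _ → 1# ∷ []) refl (λ _ → s≤s z≤n)
    open Bordered.Row one-root≢0 n (λ i j → ν L i j) (λ i j → solve 1 (λ v → :1 :* v :+ :0 := v) refl (ν L i j))

theorem6p6 : {c : Level} (F : Field c) → let open Field F in let open Setup F in
    (b a lam : ℕ → Carrier)
    (ha : (n : ℕ) → 1 ≤ n → a n ≢ 0#)
    (hP : (n : ℕ) (h : 1 ≤ n) → evalP (P b a lam n) (- lam n * inv (a n) (ha n h)) ≢ 0#)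
    (L : ℕ → Poly → Carrier) → IsMomentFunctional b a lam L →
    ((n : ℕ) → hankel L n ≢ 0#) →
    (((k : ℕ) → lam k ≢ 0#) →
      (n : ℕ) → Σ (Δ'' L n ≢ 0#) (λ nz →
        (x : Carrier) (hx : (j : ℕ) → j ≤ n → d a lam j x ≢ 0#) →
        Q b a lam n x hx ≡ inv (Δ'' L n) nz
          * det (suc n) (bordered n (λ i j → ν L (i +ℕ j) j) (lastRow'' a lam n x hx))))
    ×
    ((n : ℕ) → Σ (Δ''' L n ≢ 0#) (λ nz →
        (x : Carrier) (hx : (j : ℕ) → j ≤ n → d a lam j x ≢ 0#) →
        Q b a lam n x hx ≡ inv (Δ''' L n) nz
          * det (suc n) (bordered n (λ i j → ν L i j) (lastRow''' a lam n x hx))))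
-- The conditions on P_n(-λ_n/a_n) and on the Hankel determinants serve in the paper to construct 𝓛.
theorem6p6 F b a lam ha _ L isMoment _ = Q-bordered-monomials , Q-bordered-constants
  where open BorderedFormulas F b a lam ha L isMoment
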